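{- Fix an integer $d\ge 5$. Let $Q$ be a graph on vertex set $V=K\cup\{s_1,s_2\}$, where $s_1\neq s_2$ are not in $K$, $Q[K]$ is a clique on $d$ vertices, and (1) there exists a vertex $v\in K$ adjacent to both $s_1$ and $s_2$; (2) each of $s_1$ and $s_2$ is adjacent to at least $5$ vertices of $K$; (3) there are two vertices $a_1\neq a_2\in K$ such that $a_1$ is not adjacent to $s_1$ and $a_2$ is not adjacent to $s_2$. Then $Q$ is $(\deg-1)$-choosable. This holds regardless of whether $\{s_1,s_2\}$ is an edge of $Q$.
   Context: A graph $Q=(V,E)$ is $(\deg-1)$-choosable if for every assignment of lists $L: V\to 2^{\mathbb{N}}$ with $|L(v)|=\deg(v,Q)-1$ for all $v\in V$, there exists a proper coloring $\varphi$ of $Q$ (adjacent vertices receive distinct colors) with $\varphi(v)\in L(v)$ for all $v\in V$. -}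

module Defs where

open import Data.Nat using (ℕ; suc; _+_; _∸_; _≥_)
open import Data.Bool using (Bool; true; false; if_then_else_)
open import Data.Fin using (Fin; zero; suc)
open import Data.List using (List; length; map; allFin)
open import Data.Nat.ListAction using (sum)
open import Data.List.Membership.Propositional using (_∈_)
open import Data.List.Relation.Unary.Unique.Propositional using (Unique)
open import Data.Product using (Σ; _×_; ∃)
open import Relation.Binary.PropositionalEquality using (_≡_; _≢_)

record Graph (n : ℕ) : Set where
  field
    adj   : Fin n → Fin n → Bool
    sym   : ∀ u v → adj u v ≡ adj v u
    irr   : ∀ v → adj v v ≡ false
open Graph public

countTrue : {m : ℕ} → (Fin m → Bool) → ℕ
countTrue {m} f = sum (map (λ i → if f i then 1 else 0) (allFin m))

deg : {n : ℕ} → Graph n → Fin n → ℕ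
deg Q v = countTrue (adj Q v)

-- Q is (deg-1)-choosable: for every list assignment L with |L(v)| = deg(v) - 1
-- (lists of natural numbers without repetition represent finite sets),
-- there is a proper colouring φ with φ(v) ∈ L(v).
DegMinus1Choosable : {n : ℕ} → Graph n → Set
DegMinus1Choosable {n} Q =
  (L : Fin n → List ℕ) →
  (∀ v → Unique (L v)) →
  (∀ v → length (L v) ≡ deg Q v ∸ 1) →
  Σ (Fin n → ℕ) λ φ →
    (∀ v → φ v ∈ L v) × (∀ u v → adj Q u v ≡ true → φ u ≢ φ v)

-- Vertex set V = K ∪ {s₁, s₂} with |K| = d, realised as Fin (2 + d):
-- s₁ = 0, s₂ = 1, and the k-th vertex of K is k + 2.
s₁ : {d : ℕ} → Fin (2 + d)
s₁ = zero

s₂ : {d : ℕ} → Fin (2 + d)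
s₂ = suc zero

K : {d : ℕ} → Fin d → Fin (2 + d)
K k = suc (suc k)

module Submission where

-- Either the lists admit a system of distinct representatives, which is a proper
-- colouring, or by Hall's theorem there is a pot C of colours with fewer colours
-- than vertices whose lists lie inside C.  Lists on K have at least d - 2 colours,
-- and at least d - 1 on the neighbours of s₁, which forces |C| ≥ d - 1; so at most
-- two vertices have a list leaving C.  This leaves room to colour s₁, s₂, a₁, a₂
-- (and possibly v) so that v, or two neighbours y, z of s₁ in K, see a repeated
-- colour or one outside their own list.  Colouring the rest of K greedily, every
-- vertex still has y and z uncoloured, and the saved colours let y and then z be
-- coloured last.

open import Defs hiding (sym)
import Data.Nat
open import Data.Nat using (ℕ; zero; suc; _+_; _∸_; _≤_; _<_; _≥_; z≤n; s≤s; _≤?_)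
open import Data.Nat.Properties
open import Data.Nat.ListAction using (sum)
open import Data.Nat.Tactic.RingSolver using (solve-∀)
open import Data.Bool using (Bool; true; false; if_then_else_)
import Data.Bool.Properties as Bool
open import Data.Fin using (Fin)
import Data.Fin.Properties as Fin
open import Data.List using (List; []; _∷_; length; filter; _++_; map; allFin; deduplicate)
open import Data.List.Properties using (length-++; length-map; length-tabulate; filter-notAll; length-deduplicate)
open import Data.List.Membership.Propositional using (_∈_; _∉_; find; lose)
open import Data.List.Membership.Propositional.Properties
  using (∈-filter⁺; ∈-filter⁻; ∈-++⁺ˡ; ∈-++⁺ʳ; ∈-++⁻; ∈-map⁺; ∈-map⁻; ∈-allFin; ∈-deduplicate⁺)
open import Data.List.Relation.Binary.Subset.Propositional using (_⊆_)
open import Data.List.Relation.Binary.Disjoint.Propositional using (Disjoint)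
open import Data.List.Relation.Unary.Any as Any using (Any; here; there; any?)
open import Data.List.Relation.Unary.All as All using (All; []; _∷_; all?)
open import Data.List.Relation.Unary.All.Properties using (All¬⇒¬Any; ¬Any⇒All¬; ¬All⇒Any¬)
open import Data.List.Relation.Unary.AllPairs using (AllPairs; []; _∷_)
open import Data.List.Relation.Unary.Unique.Propositional using (Unique)
import Data.List.Relation.Unary.Unique.Propositional.Properties as Unique
open import Data.List.Relation.Unary.Unique.DecPropositional.Properties using (deduplicate-!)
open import Data.Product using (Σ; ∃; ∃-syntax; _×_; _,_; proj₁; proj₂)
open import Data.Sum using (_⊎_; inj₁; inj₂; [_,_])
open import Data.Empty using (⊥; ⊥-elim)
open import Function using (_∘_; id)
open import Algebra.Properties.CommutativeSemigroup +-commutativeSemigroup using () renaming (interchange to +-interchange)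
open import Relation.Nullary using (Dec; yes; no; ¬_; ¬?; contradiction)
open import Relation.Nullary.Decidable using (_×-dec_; decidable-stable)
open import Relation.Binary.Definitions using (DecidableEquality)
open import Relation.Binary.PropositionalEquality using (_≡_; _≢_; ≢-sym; refl; sym; trans; cong; subst; subst₂)

module Counting {A : Set} (_≟_ : DecidableEquality A) where

  open import Data.List.Membership.DecPropositional _≟_ using (_∈?_)

  _∖_ : List A → List A → List A
  xs ∖ ys = filter (¬? ∘ (_∈? ys)) xs

  ∈-∖⁺ : ∀ {x xs ys} → x ∈ xs → x ∉ ys → x ∈ xs ∖ ys
  ∈-∖⁺ {ys = ys} = ∈-filter⁺ (¬? ∘ (_∈? ys))

  ∈-∖⁻ : ∀ xs {x ys} → x ∈ xs ∖ ys → x ∈ xs × x ∉ ys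
  ∈-∖⁻ xs {ys = ys} = ∈-filter⁻ (¬? ∘ (_∈? ys)) {xs = xs}

  ∖-unique : ∀ {xs} ys → Unique xs → Unique (xs ∖ ys)
  ∖-unique ys = Unique.filter⁺ (¬? ∘ (_∈? ys))

  ∈-∖-or : ∀ {x xs} ys → x ∈ xs → x ∈ ys ⊎ x ∈ xs ∖ ys
  ∈-∖-or {x} ys x∈xs with x ∈? ys
  ... | yes x∈ys = inj₁ x∈ys
  ... | no x∉ys = inj₂ (∈-∖⁺ x∈xs x∉ys)

  length-∖< : ∀ {x xs ys} → x ∈ xs → x ∈ ys → length (xs ∖ ys) < length xs
  length-∖< {xs = xs} {ys} x∈xs x∈ys = filter-notAll (¬? ∘ (_∈? ys)) xs (lose x∈xs (λ x∉ys → x∉ys x∈ys))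

  unique-⊆⇒length≤ : ∀ {xs ys : List A} → Unique xs → xs ⊆ ys → length xs ≤ length ys
  unique-⊆⇒length≤ {[]} _ _ = z≤n
  unique-⊆⇒length≤ {x ∷ xs} {ys} (x∉xs ∷ xs!) xs⊆ys =
    ≤-trans (s≤s (unique-⊆⇒length≤ xs! ⊆ys-x)) (filter-notAll (¬? ∘ (x ≟_)) ys x-removed)
    where
    ⊆ys-x : xs ⊆ filter (¬? ∘ (x ≟_)) ys
    ⊆ys-x y∈xs = ∈-filter⁺ (¬? ∘ (x ≟_)) (xs⊆ys (there y∈xs)) (All.lookup x∉xs y∈xs)
    x-removed : Any (λ y → ¬ ¬ x ≡ y) ys
    x-removed = Any.map (λ x≡y x≢y → x≢y x≡y) (xs⊆ys (here refl))

  disjoint-⊆⇒length≤ : ∀ {xs ys zs : List A} → Unique xs → Unique ys → Disjoint xs ys →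
                        xs ⊆ zs → ys ⊆ zs → length xs + length ys ≤ length zs
  disjoint-⊆⇒length≤ {xs} xs! ys! xs#ys xs⊆zs ys⊆zs =
    subst (_≤ _) (length-++ xs)
      (unique-⊆⇒length≤ (Unique.++⁺ xs! ys! xs#ys) ([ xs⊆zs , ys⊆zs ] ∘ ∈-++⁻ xs))

  pigeonhole : ∀ {xs : List A} ys → Unique xs → length ys < length xs → ∃[ x ] x ∈ xs × x ∉ ys
  pigeonhole {xs} ys xs! ys<xs with any? (¬? ∘ (_∈? ys)) xs
  ... | yes found = find found
  ... | no none = contradiction (unique-⊆⇒length≤ xs! xs⊆ys) (<⇒≱ ys<xs)
    where
    xs⊆ys : xs ⊆ ys
    xs⊆ys {x} x∈xs = decidable-stable (x ∈? ys) (none ∘ lose x∈xs)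

  length≤∖+length : ∀ {xs} ys → Unique xs → length xs ≤ length (xs ∖ ys) + length ys
  length≤∖+length {xs} ys xs! =
    subst (length xs ≤_) (length-++ (xs ∖ ys)) (unique-⊆⇒length≤ xs! ([ ∈-++⁺ʳ (xs ∖ ys) , ∈-++⁺ˡ ] ∘ ∈-∖-or ys))

  common-∉ : ∀ {P Q : List A} C F → Unique P → Unique Q → P ⊆ C → Q ⊆ C →
             length F + length C < length P + length Q → ∃[ c ] c ∈ P × c ∈ Q × c ∉ F
  common-∉ {P} {Q} C F P! Q! P⊆C Q⊆C short with any? (λ c → c ∈? Q ×-dec ¬? (c ∈? F)) P
  ... | yes found = let c , c∈P , c∈Q , c∉F = find found in c , c∈P , c∈Q , c∉F
  ... | no none = contradiction counted (<⇒≱ short)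
    where
    P∖F#Q : Disjoint (P ∖ F) Q
    P∖F#Q (c∈P∖F , c∈Q) = let c∈P , c∉F = ∈-∖⁻ P c∈P∖F in none (lose c∈P (c∈Q , c∉F))
    counted : length P + length Q ≤ length F + length C
    counted = begin
      length P + length Q                    ≤⟨ +-monoˡ-≤ (length Q) (length≤∖+length F P!) ⟩
      length (P ∖ F) + length F + length Q   ≡⟨ cong (_+ length Q) (+-comm (length (P ∖ F)) (length F)) ⟩
      length F + length (P ∖ F) + length Q   ≡⟨ +-assoc (length F) (length (P ∖ F)) (length Q) ⟩
      length F + (length (P ∖ F) + length Q) ≤⟨ +-monoʳ-≤ (length F)
                                                  (disjoint-⊆⇒length≤ (∖-unique F P!) Q! P∖F#Q (P⊆C ∘ proj₁ ∘ ∈-∖⁻ P) Q⊆C) ⟩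
      length F + length C                    ∎
      where
        open ≤-Reasoning

  union-bound : ∀ {P Q X Y : List A} → Unique P → Unique Q → Disjoint P Q → Q ⊆ X → Q ⊆ Y →
                (∀ {p} → p ∈ P → p ∈ X ⊎ p ∈ Y) → length P + (length Q + length Q) ≤ length X + length Y
  union-bound {P} {Q} {X} {Y} P! Q! P#Q Q⊆X Q⊆Y P⊆X∪Y = begin
    length P + (length Q + length Q)                ≤⟨ +-monoˡ-≤ _ P-split ⟩
    (length Pˣ + length Pʸ) + (length Q + length Q) ≡⟨ +-interchange (length Pˣ) (length Pʸ) (length Q) (length Q) ⟩
    (length Pˣ + length Q) + (length Pʸ + length Q) ≤⟨ +-mono-≤ (R+Q≤ (Unique.filter⁺ (_∈? X) P!) Pˣ⊆P Pˣ⊆X Q⊆X)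
                                                                (R+Q≤ (∖-unique X P!) (proj₁ ∘ ∈-∖⁻ P) Pʸ⊆Y Q⊆Y) ⟩
    length X + length Y                             ∎
    where
    open ≤-Reasoning
    Pˣ = filter (_∈? X) P
    Pʸ = P ∖ X
    Pˣ⊆P : Pˣ ⊆ P
    Pˣ⊆P = proj₁ ∘ ∈-filter⁻ (_∈? X) {xs = P}
    Pˣ⊆X : Pˣ ⊆ X
    Pˣ⊆X = proj₂ ∘ ∈-filter⁻ (_∈? X) {xs = P}
    Pʸ⊆Y : Pʸ ⊆ Y
    Pʸ⊆Y p∈Pʸ with ∈-∖⁻ P p∈Pʸ
    ... | p∈P , p∉X = [ (λ p∈X → contradiction p∈X p∉X) , id ] (P⊆X∪Y p∈P)
    P-split : length P ≤ length Pˣ + length Pʸ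
    P-split = subst (length P ≤_) (length-++ Pˣ) (unique-⊆⇒length≤ P! x-or-not)
      where
      x-or-not : P ⊆ Pˣ ++ Pʸ
      x-or-not {p} p∈P with p ∈? X
      ... | yes p∈X = ∈-++⁺ˡ (∈-filter⁺ (_∈? X) p∈P p∈X)
      ... | no p∉X = ∈-++⁺ʳ Pˣ (∈-∖⁺ p∈P p∉X)
    R+Q≤ : ∀ {R Z} → Unique R → R ⊆ P → R ⊆ Z → Q ⊆ Z → length R + length Q ≤ length Z
    R+Q≤ R! R⊆P = disjoint-⊆⇒length≤ R! Q! (λ (c∈R , c∈Q) → P#Q (R⊆P c∈R , c∈Q))

module Hall {A B : Set} (_≟ᴬ_ : DecidableEquality A) (_≟ᴮ_ : DecidableEquality B) where

  open Counting _≟ᴬ_ using (unique-⊆⇒length≤; _∖_; ∈-∖⁺; ∈-∖⁻; ∖-unique; length-∖<)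
  open import Data.List.Membership.DecPropositional _≟ᴬ_ using (_∈?_)
  module Colours = Counting _≟ᴮ_

  record Transversal (vs : List A) (L : A → List B) : Set where
    field
      pick : ∀ {i} → i ∈ vs → B
      pick-∈ : ∀ {i} (i∈vs : i ∈ vs) → pick i∈vs ∈ L i
      pick-injective : ∀ {i j} (i∈vs : i ∈ vs) (j∈vs : j ∈ vs) → pick i∈vs ≡ pick j∈vs → i ≡ j

  record Obstruction (vs : List A) (L : A → List B) : Set where
    field
      members : List A
      members-unique : Unique members
      members-⊆ : members ⊆ vs
      pot : List B
      lists-⊆-pot : ∀ {i} → i ∈ members → L i ⊆ pot
      pot<members : length pot < length members

  _without_ : (A → List B) → List B → A → List B
  (L without C) i = L i Colours.∖ C

  transversal-∷ : ∀ {x xs L c} → x ∉ xs → c ∈ L x → Transversal xs (L without (c ∷ [])) → Transversal (x ∷ xs) L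
  transversal-∷ {x} {xs} {L} {c} x∉xs c∈Lx t = record { pick = pick′ ; pick-∈ = pick′-∈ ; pick-injective = pick′-inj }
    where
    open Transversal t
    pick′ : ∀ {i} → i ∈ x ∷ xs → B
    pick′ (here _) = c
    pick′ (there i∈xs) = pick i∈xs
    pick′-∈ : ∀ {i} (i∈ : i ∈ x ∷ xs) → pick′ i∈ ∈ L i
    pick′-∈ (here refl) = c∈Lx
    pick′-∈ {i} (there i∈xs) = proj₁ (Colours.∈-∖⁻ (L i) (pick-∈ i∈xs))
    avoids-c : ∀ {i} (i∈xs : i ∈ xs) → pick i∈xs ≢ c
    avoids-c {i} i∈xs pick≡c = proj₂ (Colours.∈-∖⁻ (L i) (pick-∈ i∈xs)) (here pick≡c)
    pick′-inj : ∀ {i j} (i∈ : i ∈ x ∷ xs) (j∈ : j ∈ x ∷ xs) → pick′ i∈ ≡ pick′ j∈ → i ≡ j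
    pick′-inj (here i≡x) (here j≡x) _ = trans i≡x (sym j≡x)
    pick′-inj (here _) (there j∈xs) c≡pick = contradiction (sym c≡pick) (avoids-c j∈xs)
    pick′-inj (there i∈xs) (here _) pick≡c = contradiction pick≡c (avoids-c i∈xs)
    pick′-inj (there i∈xs) (there j∈xs) same = pick-injective i∈xs j∈xs same

  transversal-∪ : ∀ {vs T L C} → (∀ {i} → i ∈ T → L i ⊆ C) → Transversal T L →
                  Transversal (vs ∖ T) (L without C) → Transversal vs L
  transversal-∪ {vs} {T} {L} {C} T⊆C t t′ = record { pick = pick ; pick-∈ = pick-∈ ; pick-injective = pick-inj }
    where
    module t = Transversal t
    module t′ = Transversal t′
    pick : ∀ {i} → i ∈ vs → B
    pick {i} i∈vs with i ∈? T
    ... | yes i∈T = t.pick i∈T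
    ... | no i∉T = t′.pick (∈-∖⁺ i∈vs i∉T)
    pick-∈ : ∀ {i} (i∈vs : i ∈ vs) → pick i∈vs ∈ L i
    pick-∈ {i} i∈vs with i ∈? T
    ... | yes i∈T = t.pick-∈ i∈T
    ... | no i∉T = proj₁ (Colours.∈-∖⁻ (L i) (t′.pick-∈ (∈-∖⁺ i∈vs i∉T)))
    outside-C : ∀ {i} (i∈ : i ∈ vs ∖ T) → t′.pick i∈ ∉ C
    outside-C {i} i∈ = proj₂ (Colours.∈-∖⁻ (L i) (t′.pick-∈ i∈))
    pick-inj : ∀ {i j} (i∈vs : i ∈ vs) (j∈vs : j ∈ vs) → pick i∈vs ≡ pick j∈vs → i ≡ j
    pick-inj {i} {j} i∈vs j∈vs same with i ∈? T | j ∈? T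
    ... | yes i∈T | yes j∈T = t.pick-injective i∈T j∈T same
    ... | no i∉T | no j∉T = t′.pick-injective (∈-∖⁺ i∈vs i∉T) (∈-∖⁺ j∈vs j∉T) same
    ... | yes i∈T | no j∉T = contradiction (subst (_∈ C) same (T⊆C i∈T (t.pick-∈ i∈T))) (outside-C (∈-∖⁺ j∈vs j∉T))
    ... | no i∉T | yes j∈T = contradiction (subst (_∈ C) (sym same) (T⊆C j∈T (t.pick-∈ j∈T))) (outside-C (∈-∖⁺ i∈vs i∉T))

  obstruction-∪ : ∀ {vs T L C} → Unique T → T ⊆ vs → (∀ {i} → i ∈ T → L i ⊆ C) → length C ≤ length T →
                  Obstruction (vs ∖ T) (L without C) → Obstruction vs L
  obstruction-∪ {vs} {T} {L} {C} T! T⊆vs T⊆C C≤T o = record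
    { members = members ++ T
    ; members-unique = Unique.++⁺ members-unique T! (λ (i∈M , i∈T) → proj₂ (from-rest i∈M) i∈T)
    ; members-⊆ = [ proj₁ ∘ from-rest , T⊆vs ] ∘ ∈-++⁻ members
    ; pot = pot ++ C
    ; lists-⊆-pot = covered
    ; pot<members = subst₂ _<_ (sym (length-++ pot)) (sym (length-++ members)) (+-mono-<-≤ pot<members C≤T)
    }
    where
    open Obstruction o
    from-rest : ∀ {i} → i ∈ members → i ∈ vs × i ∉ T
    from-rest = ∈-∖⁻ vs ∘ members-⊆
    covered : ∀ {i} → i ∈ members ++ T → L i ⊆ pot ++ C
    covered i∈ c∈Li with ∈-++⁻ members i∈
    ... | inj₂ i∈T = ∈-++⁺ʳ pot (T⊆C i∈T c∈Li)
    ... | inj₁ i∈M = [ ∈-++⁺ʳ pot , ∈-++⁺ˡ ∘ lists-⊆-pot i∈M ] (Colours.∈-∖-or C c∈Li)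

  obstruction-⊆ : ∀ {vs ws L} → vs ⊆ ws → Obstruction vs L → Obstruction ws L
  obstruction-⊆ vs⊆ws o = record { Obstruction o ; members-⊆ = vs⊆ws ∘ Obstruction.members-⊆ o }

  hall-≤ : ∀ k vs → length vs ≤ k → Unique vs → ∀ L → Transversal vs L ⊎ Obstruction vs L
  hall-≤ _ [] _ _ _ = inj₁ (record { pick = λ () ; pick-∈ = λ () ; pick-injective = λ () })
  hall-≤ (suc k) (x ∷ xs) (s≤s |xs|≤k) (x∉xs ∷ xs!) L with L x in Lx≡
  ... | [] = inj₂ (record
    { members = x ∷ [] ; members-unique = [] ∷ [] ; members-⊆ = λ { (here refl) → here refl }
    ; pot = [] ; lists-⊆-pot = λ { (here refl) → subst (_ ∈_) Lx≡ } ; pot<members = s≤s z≤n })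
  ... | c ∷ _ with hall-≤ k xs |xs|≤k xs! (L without (c ∷ []))
  ...   | inj₁ t = inj₁ (transversal-∷ (All¬⇒¬Any x∉xs) (subst (c ∈_) (sym Lx≡) (here refl)) t)
  -- The obstruction for the lists without c is a tight set T: its lists lie in
  -- c ∷ pot, which is no longer than T, so T and the rest can be handled apart.
  ...   | inj₂ o = glue (hall-≤ k T |T|≤k members-unique L) (hall-≤ k R |R|≤k (∖-unique T (x∉xs ∷ xs!)) (L without C))
    where
    open Obstruction o renaming (members to T)
    C = c ∷ pot
    T⊆C : ∀ {i} → i ∈ T → L i ⊆ C
    T⊆C i∈T = [ (λ { (here b≡c) → here b≡c }) , there ∘ lists-⊆-pot i∈T ] ∘ Colours.∈-∖-or (c ∷ [])
    |T|≤k : length T ≤ k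
    |T|≤k = ≤-trans (unique-⊆⇒length≤ members-unique members-⊆) |xs|≤k
    R = (x ∷ xs) ∖ T
    some-member : ∃[ t ] t ∈ T
    some-member with T | pot<members
    ... | t ∷ _ | _ = t , here refl
    |R|≤k : length R ≤ k
    |R|≤k = let t , t∈T = some-member in ≤-pred (≤-trans (length-∖< (there (members-⊆ t∈T)) t∈T) (s≤s |xs|≤k))
    glue : Transversal T L ⊎ Obstruction T L → Transversal R (L without C) ⊎ Obstruction R (L without C) →
           Transversal (x ∷ xs) L ⊎ Obstruction (x ∷ xs) L
    glue (inj₂ o′) _ = inj₂ (obstruction-⊆ (there ∘ members-⊆) o′)
    glue (inj₁ t) (inj₁ t′) = inj₁ (transversal-∪ T⊆C t t′)
    glue (inj₁ _) (inj₂ o′) = inj₂ (obstruction-∪ members-unique (there ∘ members-⊆) T⊆C pot<members o′)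

  hall : ∀ vs → Unique vs → ∀ L → Transversal vs L ⊎ Obstruction vs L
  hall vs = hall-≤ (length vs) vs ≤-refl

-- Degrees and greedy list colouring

countTrue≡length-filter : ∀ {m} (f : Fin m → Bool) → countTrue f ≡ length (filter (λ i → f i Bool.≟ true) (allFin m))
countTrue≡length-filter f = counted (allFin _)
  where
  counted : ∀ is → sum (map (λ i → if f i then 1 else 0) is) ≡ length (filter (λ i → f i Bool.≟ true) is)
  counted [] = refl
  counted (i ∷ is) with f i
  ... | true = cong suc (counted is)
  ... | false = counted is

module Colours = Counting Data.Nat._≟_

module GraphFacts {n} (Q : Graph n) where

  open Counting (Fin._≟_ {n}) using (unique-⊆⇒length≤)

  adjacent-sym : ∀ {u w} → adj Q u w ≡ true → adj Q w u ≡ true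
  adjacent-sym {u} {w} = trans (Graph.sym Q w u)

  adjacent⇒≢ : ∀ {u w} → adj Q u w ≡ true → u ≢ w
  adjacent⇒≢ {u} u~w refl with () ← trans (sym (irr Q u)) u~w

  neighbours-≤-deg : ∀ x {M} → Unique M → (∀ {u} → u ∈ M → adj Q x u ≡ true) → length M ≤ deg Q x
  neighbours-≤-deg x M! M~x = subst (_ ≤_) (sym (countTrue≡length-filter (adj Q x)))
    (unique-⊆⇒length≤ M! (λ {u} u∈M → ∈-filter⁺ (λ i → adj Q x i Bool.≟ true) (∈-allFin u) (M~x u∈M)))

  deg<n : ∀ x → deg Q x < n
  deg<n x = begin-strict
    deg Q x                                                   ≡⟨ countTrue≡length-filter (adj Q x) ⟩
    length (filter (λ i → adj Q x i Bool.≟ true) (allFin n))  <⟨ filter-notAll _ (allFin n) (lose (∈-allFin x) x≁x) ⟩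
    length (allFin n)                                         ≡⟨ length-tabulate id ⟩
    n                                                         ∎
    where
    open ≤-Reasoning
    x≁x : adj Q x x ≢ true
    x≁x x~x = adjacent⇒≢ x~x refl

module ListColouring {n} (Q : Graph n) (L : Fin n → List ℕ)
                     (L-unique : ∀ v → Unique (L v)) (L-size : ∀ v → length (L v) ≡ deg Q v ∸ 1) where

  V : Set
  V = Fin n

  open GraphFacts Q
  open Counting (Fin._≟_ {n}) using (unique-⊆⇒length≤; disjoint-⊆⇒length≤; _∖_; ∈-∖⁺; ∈-∖⁻; ∖-unique; ∈-∖-or)
  open import Data.List.Membership.DecPropositional (Fin._≟_ {n}) using (_∈?_)
  open import Data.List.Membership.DecPropositional Data.Nat._≟_ using () renaming (_∈?_ to _∈ℕ?_)

  Colouring : Set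
  Colouring = Σ (V → ℕ) λ φ → (∀ v → φ v ∈ L v) × (∀ u v → adj Q u v ≡ true → φ u ≢ φ v)

  neighbours-≤-list : ∀ x {M} → Unique M → (∀ {u} → u ∈ M → adj Q x u ≡ true) → length M ≤ suc (length (L x))
  neighbours-≤-list x M! M~x rewrite L-size x = ≤-trans (neighbours-≤-deg x M! M~x) (m≤n+m∸n (deg Q x) 1)

  record ProperOn (D : List V) (φ : V → ℕ) : Set where
    field
      from-lists : ∀ {i} → i ∈ D → φ i ∈ L i
      separates : ∀ {i j} → i ∈ D → j ∈ D → adj Q i j ≡ true → φ i ≢ φ j
  open ProperOn

  _[_≔_] : (V → ℕ) → V → ℕ → V → ℕ
  (φ [ w ≔ c ]) j with j Fin.≟ w
  ... | yes _ = c
  ... | no _ = φ j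

  ≔-same : ∀ φ w c → (φ [ w ≔ c ]) w ≡ c
  ≔-same φ w c with w Fin.≟ w
  ... | yes _ = refl
  ... | no w≢w = contradiction refl w≢w

  ≔-other : ∀ φ w c {j} → j ≢ w → (φ [ w ≔ c ]) j ≡ φ j
  ≔-other φ w c {j} j≢w with j Fin.≟ w
  ... | yes j≡w = contradiction j≡w j≢w
  ... | no _ = refl

  extend : ∀ {D φ w c} → ProperOn D φ → w ∉ D → c ∈ L w →
           (∀ {j} → j ∈ D → adj Q w j ≡ true → φ j ≢ c) → ProperOn (w ∷ D) (φ [ w ≔ c ])
  extend {D} {φ} {w} {c} p w∉D c∈Lw fresh = record { from-lists = in-lists ; separates = apart }
    where
    old : ∀ {j} → j ∈ D → (φ [ w ≔ c ]) j ≡ φ j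
    old j∈D = ≔-other φ w c (λ { refl → w∉D j∈D })
    in-lists : ∀ {i} → i ∈ w ∷ D → (φ [ w ≔ c ]) i ∈ L i
    in-lists (here refl) = subst (_∈ L w) (sym (≔-same φ w c)) c∈Lw
    in-lists (there i∈D) = subst (_∈ L _) (sym (old i∈D)) (from-lists p i∈D)
    apart : ∀ {i j} → i ∈ w ∷ D → j ∈ w ∷ D → adj Q i j ≡ true → (φ [ w ≔ c ]) i ≢ (φ [ w ≔ c ]) j
    apart (here refl) (here refl) w~w = contradiction refl (adjacent⇒≢ w~w)
    apart (here refl) (there j∈D) w~j rewrite ≔-same φ w c | old j∈D = fresh j∈D w~j ∘ sym
    apart (there i∈D) (here refl) i~w rewrite ≔-same φ w c | old i∈D = fresh i∈D (adjacent-sym i~w)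
    apart (there i∈D) (there j∈D) i~j rewrite old i∈D | old j∈D = separates p i∈D j∈D i~j

  colour-next : ∀ {E φ x} → ProperOn E φ → x ∉ E →
                (M : List V) → Unique M → (∀ {u} → u ∈ M → adj Q x u ≡ true) →
                (W : List ℕ) → 2 + length W ≤ length M →
                (∀ {j} → j ∈ E → adj Q x j ≡ true → φ j ∈ L x → φ j ∈ W) →
                ∃[ c ] ProperOn (x ∷ E) (φ [ x ≔ c ])
  colour-next {E} {φ} {x} p x∉E M M! M~x W W+2≤M W-covers with Colours.pigeonhole W (L-unique x) W<L
    where
    W<L : length W < length (L x)
    W<L = ≤-pred (≤-trans W+2≤M (neighbours-≤-list x M! M~x))
  ... | c , c∈Lx , c∉W = c , extend p x∉E c∈Lx (λ j∈E x~j φj≡c →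
          c∉W (subst (_∈ W) φj≡c (W-covers j∈E x~j (subst (_∈ L x) (sym φj≡c) c∈Lx))))

  colour-greedily : ∀ R {D φ} → ProperOn D φ → Unique (R ++ D) →
                    ∀ {y z} → y ≢ z → y ∉ R ++ D → z ∉ R ++ D →
                    (∀ {w} → w ∈ R → adj Q w y ≡ true × adj Q w z ≡ true) →
                    ∃[ ψ ] ProperOn (R ++ D) ψ × (∀ {j} → j ∈ D → ψ j ≡ φ j)
  colour-greedily [] p _ _ _ _ _ = _ , p , λ _ → refl
  colour-greedily (w ∷ R) {D} p (w∉ ∷ RD!) {y} {z} y≢z y∉ z∉ R~yz
    with colour-greedily R p RD! y≢z (y∉ ∘ there) (z∉ ∘ there) (R~yz ∘ there)
  ... | ψ , pψ , agree = ψ [ w ≔ c ] , p′ , λ j∈D → trans (≔-other ψ w c (w≢ j∈D ∘ sym)) (agree j∈D)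
    where
    w~? : ∀ j → Dec (adj Q w j ≡ true)
    w~? j = adj Q w j Bool.≟ true
    nbrs = filter w~? (R ++ D)
    nbrs⊆ : nbrs ⊆ R ++ D
    nbrs⊆ = proj₁ ∘ ∈-filter⁻ w~? {xs = R ++ D}
    M! : Unique (nbrs ++ y ∷ z ∷ [])
    M! = Unique.++⁺ (Unique.filter⁺ w~? RD!) ((y≢z ∷ []) ∷ [] ∷ [])
           λ { (u∈ , here refl) → y∉ (there (nbrs⊆ u∈)) ; (u∈ , there (here refl)) → z∉ (there (nbrs⊆ u∈)) }
    M~w : ∀ {u} → u ∈ nbrs ++ y ∷ z ∷ [] → adj Q w u ≡ true
    M~w u∈ with ∈-++⁻ nbrs u∈
    ... | inj₁ u∈nbrs = proj₂ (∈-filter⁻ w~? {xs = R ++ D} u∈nbrs)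
    ... | inj₂ (here refl) = proj₁ (R~yz (here refl))
    ... | inj₂ (there (here refl)) = proj₂ (R~yz (here refl))
    count : 2 + length (map ψ nbrs) ≤ length (nbrs ++ y ∷ z ∷ [])
    count rewrite length-map ψ nbrs | length-++ nbrs {y ∷ z ∷ []} = ≤-reflexive (+-comm 2 (length nbrs))
    next = colour-next pψ (All¬⇒¬Any w∉) (nbrs ++ y ∷ z ∷ []) M! M~w (map ψ nbrs) count
             (λ j∈ w~j _ → ∈-map⁺ ψ (∈-filter⁺ w~? j∈ w~j))
    c = proj₁ next
    p′ = proj₂ next
    w≢ : ∀ {j} → j ∈ D → w ≢ j
    w≢ j∈D = All.lookup w∉ (∈-++⁺ʳ R j∈D)

  Listed : V × ℕ → Set
  Listed (x , c) = c ∈ L x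

  Apart : V × ℕ → V × ℕ → Set
  Apart (x , c) (x′ , c′) = adj Q x x′ ≡ true → c ≢ c′

  record Precolouring : Set where
    field
      entries : List (V × ℕ)
      keys-unique : Unique (map proj₁ entries)
      listed : All Listed entries
      apart : AllPairs Apart entries

    keys : List V
    keys = map proj₁ entries

  extend-precolouring : (P : Precolouring) → ∀ {x c} → x ∉ Precolouring.keys P → c ∈ L x →
                        (∀ {u e} → (u , e) ∈ Precolouring.entries P → adj Q x u ≡ true → c ≢ e) → Precolouring
  extend-precolouring P {x} {c} x∉keys c∈Lx fresh = record
    { entries = (x , c) ∷ entries
    ; keys-unique = ¬Any⇒All¬ keys x∉keys ∷ keys-unique
    ; listed = c∈Lx ∷ listed
    ; apart = All.tabulate fresh ∷ apart
    }
    where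
      open Precolouring P

  assign : List (V × ℕ) → V → ℕ
  assign [] _ = 0
  assign ((x , c) ∷ es) = assign es [ x ≔ c ]

  assign-∈ : ∀ es → Unique (map proj₁ es) → ∀ {x c} → (x , c) ∈ es → assign es x ≡ c
  assign-∈ ((x , c) ∷ es) _ (here refl) = ≔-same (assign es) x c
  assign-∈ ((x′ , c′) ∷ es) (x′∉ ∷ es!) {x} (there x,c∈es) =
    trans (≔-other (assign es) x′ c′ (λ { refl → All.lookup x′∉ (∈-map⁺ proj₁ x,c∈es) refl })) (assign-∈ es es! x,c∈es)

  assign-key : ∀ es → Unique (map proj₁ es) → ∀ {x} → x ∈ map proj₁ es → (x , assign es x) ∈ es
  assign-key es es! x∈keys with ∈-map⁻ proj₁ x∈keys
  ... | (x , c) , x,c∈es , refl = subst (λ c′ → (x , c′) ∈ es) (sym (assign-∈ es es! x,c∈es)) x,c∈es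

  assign-proper : ∀ es → Unique (map proj₁ es) → All Listed es → AllPairs Apart es → ProperOn (map proj₁ es) (assign es)
  assign-proper [] _ _ _ = record { from-lists = λ () ; separates = λ () }
  assign-proper ((x , c) ∷ es) (x∉ ∷ es!) (c∈Lx ∷ in-lists) (x-apart ∷ apart) =
    extend (assign-proper es es! in-lists apart) (All¬⇒¬Any x∉) c∈Lx differs
    where
    differs : ∀ {j} → j ∈ map proj₁ es → adj Q x j ≡ true → assign es j ≢ c
    differs j∈keys x~j = All.lookup x-apart (assign-key es es! j∈keys) x~j ∘ sym

  -- The precoloured neighbours in seen show x at most length seen - k colours of
  -- its list, all of them in palette.
  record Slack (P : Precolouring) (x : V) (k : ℕ) : Set where
    open Precolouring P
    field
      seen : List V
      seen-unique : Unique seen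
      seen-precoloured : seen ⊆ keys
      seen-adjacent : ∀ {u} → u ∈ seen → adj Q x u ≡ true
      palette : List ℕ
      palette-small : k + length palette ≤ length seen
      palette-covers : ∀ {u c} → (u , c) ∈ entries → adj Q x u ≡ true → c ∈ L x → c ∈ palette

  module _ (P : Precolouring) where
    open Precolouring P

    colour-with-slack : ∀ F {ψ x k} → ProperOn (F ++ keys) ψ → x ∉ F ++ keys → Unique F → Disjoint F keys →
                        (∀ {j} → j ∈ keys → ψ j ≡ assign entries j) → (∀ {w} → w ∈ F → adj Q x w ≡ true) →
                        (later : List V) → Unique later → (∀ {u} → u ∈ later → u ∉ F ++ keys × adj Q x u ≡ true) →
                        2 ≤ k + length later → Slack P x k → ∃[ c ] ProperOn (x ∷ F ++ keys) (ψ [ x ≔ c ])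
    colour-with-slack F {ψ} {x} {k} p x∉ F! F#keys agree x~F later later! later-spec enough s =
      colour-next p x∉ (seen ++ F ++ later) M! M~x (palette ++ map ψ F) count covers
      where
      open Slack s
      M! : Unique (seen ++ F ++ later)
      M! = Unique.++⁺ seen-unique (Unique.++⁺ F! later! (λ (u∈F , u∈later) → proj₁ (later-spec u∈later) (∈-++⁺ˡ u∈F)))
             λ (u∈seen , u∈F++later) → [ (λ u∈F → F#keys (u∈F , seen-precoloured u∈seen))
                                       , (λ u∈later → proj₁ (later-spec u∈later) (∈-++⁺ʳ F (seen-precoloured u∈seen))) ]
                                       (∈-++⁻ F u∈F++later)
      M~x : ∀ {u} → u ∈ seen ++ F ++ later → adj Q x u ≡ true
      M~x u∈M with ∈-++⁻ seen u∈M
      ... | inj₁ u∈seen = seen-adjacent u∈seen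
      ... | inj₂ u∈F++later = [ x~F , proj₂ ∘ later-spec ] (∈-++⁻ F u∈F++later)
      count : 2 + length (palette ++ map ψ F) ≤ length (seen ++ F ++ later)
      count = begin
        2 + length (palette ++ map ψ F)                        ≡⟨ cong (2 +_) (trans (length-++ palette) (cong (length palette +_) (length-map ψ F))) ⟩
        2 + (length palette + length F)                        ≤⟨ +-monoˡ-≤ _ enough ⟩
        (k + length later) + (length palette + length F)       ≡⟨ +-interchange k (length later) (length palette) (length F) ⟩
        (k + length palette) + (length later + length F)       ≤⟨ +-mono-≤ palette-small (≤-reflexive (+-comm (length later) (length F))) ⟩
        length seen + (length F + length later)                ≡⟨ trans (cong (length seen +_) (sym (length-++ F))) (sym (length-++ seen)) ⟩
        length (seen ++ F ++ later)                            ∎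
        where
          open ≤-Reasoning
      covers : ∀ {j} → j ∈ F ++ keys → adj Q x j ≡ true → ψ j ∈ L x → ψ j ∈ palette ++ map ψ F
      covers j∈ x~j ψj∈Lx with ∈-++⁻ F j∈
      ... | inj₁ j∈F = ∈-++⁺ʳ palette (∈-map⁺ ψ j∈F)
      ... | inj₂ j∈keys = ∈-++⁺ˡ (subst (_∈ palette) (sym (agree j∈keys))
                            (palette-covers (assign-key entries keys-unique j∈keys) x~j (subst (_∈ L x) (agree j∈keys) ψj∈Lx)))

    colour-last-two : ∀ R {ψ y z} → ProperOn (R ++ keys) ψ → Unique R → Disjoint R keys →
                      (∀ {j} → j ∈ keys → ψ j ≡ assign entries j) →
                      y ≢ z → y ∉ R ++ keys → z ∉ R ++ keys → adj Q y z ≡ true →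
                      (∀ {w} → w ∈ R → adj Q w y ≡ true × adj Q w z ≡ true) →
                      Slack P y 1 → Slack P z 2 → ∃[ χ ] ProperOn (z ∷ y ∷ R ++ keys) χ
    colour-last-two R {ψ} {y} {z} p R! R#keys agree y≢z y∉ z∉ y~z R~yz slack-y slack-z =
      _ , proj₂ step-z
      where
      step-y = colour-with-slack R p y∉ R! R#keys agree (adjacent-sym ∘ proj₁ ∘ R~yz)
                 (z ∷ []) ([] ∷ []) (λ { (here refl) → z∉ , y~z }) ≤-refl slack-y
      y∉keys : y ∉ keys
      y∉keys = y∉ ∘ ∈-++⁺ʳ R
      z∉y∷ : z ∉ y ∷ R ++ keys
      z∉y∷ (here z≡y) = y≢z (sym z≡y)
      z∉y∷ (there z∈) = z∉ z∈
      y∷R#keys : Disjoint (y ∷ R) keys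
      y∷R#keys (here refl , y∈keys) = y∉keys y∈keys
      y∷R#keys (there w∈R , w∈keys) = R#keys (w∈R , w∈keys)
      agree-y : ∀ {j} → j ∈ keys → (ψ [ y ≔ proj₁ step-y ]) j ≡ assign entries j
      agree-y j∈keys = trans (≔-other ψ y _ (λ { refl → y∉keys j∈keys })) (agree j∈keys)
      z~y∷R : ∀ {w} → w ∈ y ∷ R → adj Q z w ≡ true
      z~y∷R (here refl) = adjacent-sym y~z
      z~y∷R (there w∈R) = adjacent-sym (proj₂ (R~yz w∈R))
      step-z = colour-with-slack (y ∷ R) (proj₂ step-y) z∉y∷ (¬Any⇒All¬ R (y∉ ∘ ∈-++⁺ˡ) ∷ R!) y∷R#keys agree-y z~y∷R
                 [] [] (λ ()) ≤-refl slack-z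

    -- Every other vertex keeps two uncoloured neighbours y and z while it is
    -- coloured greedily; y and z are finished with their slack.
    complete : ∀ {y z} → y ≢ z → y ∉ keys → z ∉ keys → adj Q y z ≡ true →
               (∀ {w} → w ∉ keys → w ≢ y → w ≢ z → adj Q w y ≡ true × adj Q w z ≡ true) →
               Slack P y 1 → Slack P z 2 → Colouring
    complete {y} {z} y≢z y∉keys z∉keys y~z rest~yz slack-y slack-z =
      χ , (λ v → from-lists pχ (everyone v)) , (λ u v → separates pχ (everyone u) (everyone v))
      where
      R = allFin n ∖ (y ∷ z ∷ keys)
      R-spec : ∀ {w} → w ∈ R → w ∉ y ∷ z ∷ keys
      R-spec = proj₂ ∘ ∈-∖⁻ (allFin n)
      R! : Unique R
      R! = ∖-unique (y ∷ z ∷ keys) (Unique.allFin⁺ n)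
      R#keys : Disjoint R keys
      R#keys (w∈R , w∈keys) = R-spec w∈R (there (there w∈keys))
      y∉ : y ∉ R ++ keys
      y∉ = [ (λ y∈R → R-spec y∈R (here refl)) , y∉keys ] ∘ ∈-++⁻ R
      z∉ : z ∉ R ++ keys
      z∉ = [ (λ z∈R → R-spec z∈R (there (here refl))) , z∉keys ] ∘ ∈-++⁻ R
      R~yz : ∀ {w} → w ∈ R → adj Q w y ≡ true × adj Q w z ≡ true
      R~yz w∈R = rest~yz (R-spec w∈R ∘ there ∘ there) (R-spec w∈R ∘ here) (R-spec w∈R ∘ there ∘ here)
      greedy = colour-greedily R (assign-proper entries keys-unique listed apart)
                 (Unique.++⁺ R! keys-unique R#keys) y≢z y∉ z∉ R~yz
      last-two = colour-last-two R (proj₁ (proj₂ greedy)) R! R#keys (proj₂ (proj₂ greedy))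
                   y≢z y∉ z∉ y~z R~yz slack-y slack-z
      χ = proj₁ last-two
      pχ = proj₂ last-two
      everyone : ∀ v → v ∈ z ∷ y ∷ R ++ keys
      everyone v with ∈-∖-or (y ∷ z ∷ keys) (∈-allFin v)
      ... | inj₁ (here refl) = there (here refl)
      ... | inj₁ (there (here refl)) = here refl
      ... | inj₁ (there (there v∈keys)) = there (there (∈-++⁺ʳ R v∈keys))
      ... | inj₂ v∈R = there (there (∈-++⁺ˡ v∈R))

    slack : ∀ {x k} seen → Unique seen → seen ⊆ keys → (∀ {u} → u ∈ seen → adj Q x u ≡ true) →
            (W : List ℕ) → k + length W ≤ length seen →
            (∀ {c} → c ∈ map proj₂ entries → c ∈ L x → c ∈ W) → Slack P x k
    slack seen seen! seen⊆ seen~ W small absorbs = record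
      { seen = seen ; seen-unique = seen! ; seen-precoloured = seen⊆ ; seen-adjacent = seen~
      ; palette = W ; palette-small = small ; palette-covers = λ u,c∈ _ → absorbs (∈-map⁺ proj₂ u,c∈) }

  transversal⇒colouring : Hall.Transversal Fin._≟_ Data.Nat._≟_ (allFin n) L → Colouring
  transversal⇒colouring t = pick ∘ ∈-allFin , pick-∈ ∘ ∈-allFin , apart
    where
    open Hall.Transversal t
    apart : ∀ u w → adj Q u w ≡ true → pick (∈-allFin u) ≢ pick (∈-allFin w)
    apart u w u~w same = adjacent⇒≢ u~w (pick-injective (∈-allFin u) (∈-allFin w) same)

  Within : List ℕ → V → Set
  Within C x = All (_∈ C) (L x)

  within? : ∀ C x → Dec (Within C x)
  within? C x = all? (_∈ℕ? C) (L x)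

  record Pot : Set where
    field
      pot : List ℕ
      pot-unique : Unique pot
      crowded : length pot < length (filter (within? pot) (allFin n))

  colouring-or-pot : Colouring ⊎ Pot
  colouring-or-pot with Hall.hall Fin._≟_ Data.Nat._≟_ (allFin n) (Unique.allFin⁺ n) L
  ... | inj₁ t = inj₁ (transversal⇒colouring t)
  ... | inj₂ o = inj₂ (record { pot = C ; pot-unique = deduplicate-! Data.Nat._≟_ pot ; crowded = crowded })
    where
    open Hall.Obstruction o
    C = deduplicate Data.Nat._≟_ pot
    crowded : length C < length (filter (within? C) (allFin n))
    crowded = ≤-trans (s≤s (length-deduplicate Data.Nat._≟_ pot)) (≤-trans pot<members
      (unique-⊆⇒length≤ members-unique (λ {i} i∈ → ∈-filter⁺ (within? C) (∈-allFin i)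
        (All.tabulate (∈-deduplicate⁺ Data.Nat._≟_ ∘ lists-⊆-pot i∈)))))

  module PotProperties (π : Pot) where
    open Pot π

    Inside : V → Set
    Inside = Within pot

    D : List V
    D = filter (within? pot) (allFin n)

    D! : Unique D
    D! = Unique.filter⁺ (within? pot) (Unique.allFin⁺ n)

    D-inside : ∀ {x} → x ∈ D → Inside x
    D-inside = proj₂ ∘ ∈-filter⁻ (within? pot) {xs = allFin n}

    inside-⊆ : ∀ {x} → Inside x → L x ⊆ pot
    inside-⊆ x-inside = All.lookup x-inside

    inside-≤ : ∀ {x} → Inside x → length (L x) ≤ length pot
    inside-≤ {x} x-inside = Colours.unique-⊆⇒length≤ (L-unique x) (inside-⊆ x-inside)

    escape : ∀ {x} → ¬ Inside x → ∃[ c ] c ∈ L x × c ∉ pot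
    escape {x} x-outside = find (¬All⇒Any¬ (_∈ℕ? pot) (L x) x-outside)

    shared : ∀ {x y} → Inside x → Inside y → ∀ F → length F + length pot < length (L x) + length (L y) →
             ∃[ c ] c ∈ L x × c ∈ L y × c ∉ F
    shared {x} {y} x-inside y-inside F =
      Colours.common-∉ pot F (L-unique x) (L-unique y) (inside-⊆ x-inside) (inside-⊆ y-inside)

    room : ∀ M → Unique M → (∀ {u} → u ∈ M → ¬ Inside u) → length M + length pot < n
    room M M! M-outside = begin-strict
      length M + length pot   <⟨ +-monoʳ-< (length M) crowded ⟩
      length M + length D     ≡⟨ +-comm (length M) (length D) ⟩
      length D + length M     ≤⟨ disjoint-⊆⇒length≤ D! M! (λ (u∈D , u∈M) → M-outside u∈M (D-inside u∈D))
                                   (λ {u} _ → ∈-allFin u) (λ {u} _ → ∈-allFin u) ⟩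
      length (allFin n)       ≡⟨ length-tabulate id ⟩
      n                       ∎
      where
        open ≤-Reasoning

-- The configuration of the theorem, with d = 5 + m

module Analysis (m : ℕ) (Q : Graph (7 + m)) (L : Fin (7 + m) → List ℕ)
                (L-unique : ∀ v → Unique (L v)) (L-size : ∀ v → length (L v) ≡ deg Q v ∸ 1) where

  open GraphFacts Q
  open ListColouring Q L L-unique L-size
  open Counting (Fin._≟_ {7 + m}) using (disjoint-⊆⇒length≤; pigeonhole; _∖_; ∈-∖⁻; ∖-unique; length≤∖+length)
  open import Data.List.Membership.DecPropositional Data.Nat._≟_ using () renaming (_∈?_ to _∈ℕ?_)
  open import Data.List.Membership.DecPropositional (Fin._≟_ {7 + m}) using (_∈?_)

  -- σ₁, σ₂ are s₁, s₂ in either order and α₁, α₂, v are a₁, a₂, v accordingly;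
  -- N₁, N₂ list the neighbours of σ₁, σ₂ in K, the vertices other than σ₁, σ₂.
  record Frame : Set where
    field
      σ₁ σ₂ α₁ α₂ v : V
      σ₁≢σ₂ : σ₁ ≢ σ₂
      clique : ∀ {u w} → u ≢ σ₁ → u ≢ σ₂ → w ≢ σ₁ → w ≢ σ₂ → u ≢ w → adj Q u w ≡ true
      α₁≢σ₁ : α₁ ≢ σ₁
      α₁≢σ₂ : α₁ ≢ σ₂
      α₂≢σ₁ : α₂ ≢ σ₁
      α₂≢σ₂ : α₂ ≢ σ₂
      α₁≢α₂ : α₁ ≢ α₂
      σ₁≁α₁ : adj Q σ₁ α₁ ≢ true
      σ₂≁α₂ : adj Q σ₂ α₂ ≢ true
      v~σ₁ : adj Q v σ₁ ≡ true
      v~σ₂ : adj Q v σ₂ ≡ true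
      N₁ N₂ : List V
      N₁-unique : Unique N₁
      N₂-unique : Unique N₂
      N₁~σ₁ : ∀ {u} → u ∈ N₁ → adj Q u σ₁ ≡ true
      N₂~σ₂ : ∀ {u} → u ∈ N₂ → adj Q u σ₂ ≡ true
      N₁≢σ₂ : ∀ {u} → u ∈ N₁ → u ≢ σ₂
      N₂≢σ₁ : ∀ {u} → u ∈ N₂ → u ≢ σ₁
      N₁-large : 5 ≤ length N₁
      N₂-large : 5 ≤ length N₂

  swap : Frame → Frame
  swap F = record
    { σ₁ = σ₂ ; σ₂ = σ₁ ; α₁ = α₂ ; α₂ = α₁ ; v = v ; σ₁≢σ₂ = ≢-sym σ₁≢σ₂
    ; clique = λ u≢σ₂ u≢σ₁ w≢σ₂ w≢σ₁ → clique u≢σ₁ u≢σ₂ w≢σ₁ w≢σ₂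
    ; α₁≢σ₁ = α₂≢σ₂ ; α₁≢σ₂ = α₂≢σ₁ ; α₂≢σ₁ = α₁≢σ₂ ; α₂≢σ₂ = α₁≢σ₁ ; α₁≢α₂ = ≢-sym α₁≢α₂
    ; σ₁≁α₁ = σ₂≁α₂ ; σ₂≁α₂ = σ₁≁α₁ ; v~σ₁ = v~σ₂ ; v~σ₂ = v~σ₁
    ; N₁ = N₂ ; N₂ = N₁ ; N₁-unique = N₂-unique ; N₂-unique = N₁-unique ; N₁~σ₁ = N₂~σ₂ ; N₂~σ₂ = N₁~σ₁
    ; N₁≢σ₂ = N₂≢σ₁ ; N₂≢σ₁ = N₁≢σ₂ ; N₁-large = N₂-large ; N₂-large = N₁-large
    }
    where
      open Frame F

  list≤5+m : ∀ x → length (L x) ≤ 5 + m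
  list≤5+m x rewrite L-size x = ∸-monoˡ-≤ 1 (≤-pred (deg<n x))

  module FrameFacts (F : Frame) where
    open Frame F

    Core : V → Set
    Core w = w ≢ σ₁ × w ≢ σ₂

    adjacent-core : ∀ {u w} → Core u → Core w → u ≢ w → adj Q u w ≡ true
    adjacent-core (u≢σ₁ , u≢σ₂) (w≢σ₁ , w≢σ₂) = clique u≢σ₁ u≢σ₂ w≢σ₁ w≢σ₂

    N₁-core : ∀ {u} → u ∈ N₁ → Core u
    N₁-core u∈N₁ = adjacent⇒≢ (N₁~σ₁ u∈N₁) , N₁≢σ₂ u∈N₁

    N₁≢α₁ : ∀ {u} → u ∈ N₁ → u ≢ α₁
    N₁≢α₁ u∈N₁ refl = σ₁≁α₁ (adjacent-sym (N₁~σ₁ u∈N₁))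

    v-core : Core v
    v-core = adjacent⇒≢ v~σ₁ , adjacent⇒≢ v~σ₂

    α₁-core : Core α₁
    α₁-core = α₁≢σ₁ , α₁≢σ₂

    α₂-core : Core α₂
    α₂-core = α₂≢σ₁ , α₂≢σ₂

    v≢α₁ : v ≢ α₁
    v≢α₁ refl = σ₁≁α₁ (adjacent-sym v~σ₁)

    v≢α₂ : v ≢ α₂
    v≢α₂ refl = σ₂≁α₂ (adjacent-sym v~σ₂)

    core-list : ∀ {w} → Core w → (E : List V) → Unique E → E ⊆ σ₁ ∷ σ₂ ∷ [] →
                (∀ {e} → e ∈ E → adj Q w e ≡ true) → length E + (3 + m) ≤ length (L w)
    core-list {w} w-core E E! E⊆σs w~E = ≤-pred (begin
      suc (length E + (3 + m))        ≡⟨ cong suc (+-comm (length E) (3 + m)) ⟩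
      4 + m + length E               ≤⟨ +-monoˡ-≤ (length E) many-others ⟩
      length others + length E       ≡⟨ length-++ others ⟨
      length (others ++ E)           ≤⟨ neighbours-≤-list w M! M~w ⟩
      suc (length (L w))             ∎)
      where
      open ≤-Reasoning
      excluded = σ₁ ∷ σ₂ ∷ w ∷ []
      others = allFin (7 + m) ∖ excluded
      other-spec : ∀ {u} → u ∈ others → u ∉ excluded
      other-spec = proj₂ ∘ ∈-∖⁻ (allFin (7 + m))
      many-others : 4 + m ≤ length others
      many-others = +-cancelʳ-≤ 3 (4 + m) (length others)
        (subst (_≤ length others + 3) (trans (length-tabulate id) (+-comm 3 (4 + m)))
          (length≤∖+length excluded (Unique.allFin⁺ (7 + m))))
      M! : Unique (others ++ E)
      M! = Unique.++⁺ (∖-unique excluded (Unique.allFin⁺ (7 + m))) E!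
             λ (u∈others , u∈E) → other-spec u∈others (σ∈excluded (E⊆σs u∈E))
        where
        σ∈excluded : ∀ {u} → u ∈ σ₁ ∷ σ₂ ∷ [] → u ∈ excluded
        σ∈excluded (here u≡σ₁) = here u≡σ₁
        σ∈excluded (there (here u≡σ₂)) = there (here u≡σ₂)
      M~w : ∀ {u} → u ∈ others ++ E → adj Q w u ≡ true
      M~w u∈M with ∈-++⁻ others u∈M
      ... | inj₂ u∈E = w~E u∈E
      ... | inj₁ u∈others = adjacent-core w-core (other-spec u∈others ∘ here , other-spec u∈others ∘ there ∘ here)
                              (other-spec u∈others ∘ there ∘ there ∘ here ∘ sym)

    core-list≥3+m : ∀ {w} → Core w → 3 + m ≤ length (L w)
    core-list≥3+m w-core = core-list w-core [] [] (λ ()) (λ ())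

    core-list≥4+m : ∀ {w σ} → Core w → σ ∈ σ₁ ∷ σ₂ ∷ [] → adj Q w σ ≡ true → 4 + m ≤ length (L w)
    core-list≥4+m w-core σ∈σs w~σ =
      core-list w-core (_ ∷ []) ([] ∷ []) (λ { (here refl) → σ∈σs }) (λ { (here refl) → w~σ })

    v-list≥5+m : 5 + m ≤ length (L v)
    v-list≥5+m = core-list v-core (σ₁ ∷ σ₂ ∷ []) ((σ₁≢σ₂ ∷ []) ∷ [] ∷ []) id
      (λ { (here refl) → v~σ₁ ; (there (here refl)) → v~σ₂ })

    σ₁-list≥4 : 4 ≤ length (L σ₁)
    σ₁-list≥4 = ≤-pred (≤-trans N₁-large (neighbours-≤-list σ₁ N₁-unique (adjacent-sym ∘ N₁~σ₁)))

    σ₁-list≥5 : adj Q σ₁ σ₂ ≡ true → 5 ≤ length (L σ₁)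
    σ₁-list≥5 σ₁~σ₂ = ≤-pred (≤-trans (s≤s N₁-large)
      (neighbours-≤-list σ₁ (¬Any⇒All¬ N₁ σ₂∉N₁ ∷ N₁-unique)
        (λ { (here refl) → σ₁~σ₂ ; (there u∈N₁) → adjacent-sym (N₁~σ₁ u∈N₁) })))
      where
      σ₂∉N₁ : ¬ Any (σ₂ ≡_) N₁
      σ₂∉N₁ σ₂∈N₁ = N₁≢σ₂ σ₂∈N₁ refl

    N₁-avoiding : ∀ X → length X < 5 → ∃[ y ] y ∈ N₁ × y ∉ X
    N₁-avoiding X X<5 = pigeonhole X N₁-unique (≤-trans X<5 N₁-large)

    Absorbs : V → List ℕ → List ℕ → Set
    Absorbs x W cs = ∀ {c} → c ∈ cs → c ∈ L x → c ∈ W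

    rest-adjacent : ∀ {keys y z} → σ₁ ∈ keys → σ₂ ∈ keys → Core y → Core z →
                    ∀ {w} → w ∉ keys → w ≢ y → w ≢ z → adj Q w y ≡ true × adj Q w z ≡ true
    rest-adjacent σ₁∈ σ₂∈ y-core z-core w∉ w≢y w≢z =
      adjacent-core w-core y-core w≢y , adjacent-core w-core z-core w≢z
      where
      w-core : Core _
      w-core = (λ { refl → w∉ σ₁∈ }) , (λ { refl → w∉ σ₂∈ })

    σα-precolouring : ∀ {c₁ c₂ b₁ b₂} → c₁ ∈ L σ₁ → c₂ ∈ L σ₂ → b₁ ∈ L α₁ → b₂ ∈ L α₂ →
                      (adj Q σ₁ σ₂ ≡ true → c₁ ≢ c₂) → (adj Q σ₁ α₂ ≡ true → c₁ ≢ b₂) →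
                      (adj Q σ₂ α₁ ≡ true → c₂ ≢ b₁) → b₁ ≢ b₂ → Precolouring
    σα-precolouring {c₁} {c₂} {b₁} {b₂} c₁∈ c₂∈ b₁∈ b₂∈ σ₁σ₂ σ₁α₂ σ₂α₁ b₁≢b₂ = record
      { entries = (σ₁ , c₁) ∷ (σ₂ , c₂) ∷ (α₁ , b₁) ∷ (α₂ , b₂) ∷ []
      ; keys-unique = (σ₁≢σ₂ ∷ ≢-sym α₁≢σ₁ ∷ ≢-sym α₂≢σ₁ ∷ []) ∷ (≢-sym α₁≢σ₂ ∷ ≢-sym α₂≢σ₂ ∷ []) ∷ (α₁≢α₂ ∷ []) ∷ [] ∷ []
      ; listed = c₁∈ ∷ c₂∈ ∷ b₁∈ ∷ b₂∈ ∷ []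
      ; apart = (σ₁σ₂ ∷ vacuous σ₁≁α₁ ∷ σ₁α₂ ∷ []) ∷ (σ₂α₁ ∷ vacuous σ₂≁α₂ ∷ []) ∷ ((λ _ → b₁≢b₂) ∷ []) ∷ [] ∷ []
      }
      where
      vacuous : ∀ {u w} {c c′ : ℕ} → adj Q u w ≢ true → adj Q u w ≡ true → c ≢ c′
      vacuous u≁w u~w = contradiction u~w u≁w

    colour-σα-then-v : ∀ {c₁ c₂ b₁ b₂} → c₁ ∈ L σ₁ → c₂ ∈ L σ₂ → b₁ ∈ L α₁ → b₂ ∈ L α₂ →
                       (adj Q σ₁ σ₂ ≡ true → c₁ ≢ c₂) → (adj Q σ₁ α₂ ≡ true → c₁ ≢ b₂) →
                       (adj Q σ₂ α₁ ≡ true → c₂ ≢ b₁) → b₁ ≢ b₂ →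
                       ∃[ W ] length W ≤ 2 × Absorbs v W (c₁ ∷ c₂ ∷ b₁ ∷ b₂ ∷ []) →
                       (∀ {y} → y ∈ N₁ → y ≢ v → y ≢ α₂ → ∃[ W ] length W ≤ 2 × Absorbs y W (c₁ ∷ c₂ ∷ b₁ ∷ b₂ ∷ [])) →
                       Colouring
    colour-σα-then-v c₁∈ c₂∈ b₁∈ b₂∈ σ₁σ₂ σ₁α₂ σ₂α₁ b₁≢b₂ (Wv , |Wv|≤2 , Wv-absorbs) y-absorbed
      with N₁-avoiding (v ∷ α₂ ∷ []) (s≤s (s≤s (s≤s z≤n)))
    ... | y , y∈N₁ , y∉ with y-absorbed y∈N₁ (y∉ ∘ here) (y∉ ∘ there ∘ here)
    ...   | Wy , |Wy|≤2 , Wy-absorbs =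
      complete P y≢v y∉keys v∉keys (adjacent-core y-core v-core y≢v)
        (rest-adjacent (here refl) (there (here refl)) y-core v-core) slack-y slack-v
      where
      P = σα-precolouring c₁∈ c₂∈ b₁∈ b₂∈ σ₁σ₂ σ₁α₂ σ₂α₁ b₁≢b₂
      open Precolouring P using (keys; keys-unique)
      y-core = N₁-core y∈N₁
      y≢v = y∉ ∘ here
      y≢α₁ = N₁≢α₁ y∈N₁
      y≢α₂ = y∉ ∘ there ∘ here
      y∉keys : y ∉ keys
      y∉keys = All¬⇒¬Any (proj₁ y-core ∷ proj₂ y-core ∷ y≢α₁ ∷ y≢α₂ ∷ [])
      v∉keys : v ∉ keys
      v∉keys = All¬⇒¬Any (proj₁ v-core ∷ proj₂ v-core ∷ v≢α₁ ∷ v≢α₂ ∷ [])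
      slack-v : Slack P v 2
      slack-v = slack P keys keys-unique id
        (λ { (here refl) → v~σ₁ ; (there (here refl)) → v~σ₂
           ; (there (there (here refl))) → adjacent-core v-core α₁-core v≢α₁
           ; (there (there (there (here refl)))) → adjacent-core v-core α₂-core v≢α₂ })
        Wv (s≤s (s≤s |Wv|≤2)) Wv-absorbs
      slack-y : Slack P y 1
      slack-y = slack P (σ₁ ∷ α₁ ∷ α₂ ∷ []) ((≢-sym α₁≢σ₁ ∷ ≢-sym α₂≢σ₁ ∷ []) ∷ (α₁≢α₂ ∷ []) ∷ [] ∷ [])
        (λ { (here refl) → here refl ; (there (here refl)) → there (there (here refl))
           ; (there (there (here refl))) → there (there (there (here refl))) })
        (λ { (here refl) → N₁~σ₁ y∈N₁
           ; (there (here refl)) → adjacent-core y-core α₁-core y≢α₁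
           ; (there (there (here refl))) → adjacent-core y-core α₂-core y≢α₂ })
        Wy (s≤s |Wy|≤2) Wy-absorbs

    colour-σαv-then-two : ∀ {c₁ c₂ b₁ o} → c₁ ∈ L σ₁ → c₂ ∈ L σ₂ → c₂ ∈ L α₂ → b₁ ∈ L α₁ → o ∈ L v →
                          c₁ ≢ c₂ → b₁ ≢ c₁ → b₁ ≢ c₂ → o ≢ c₁ → o ≢ c₂ → b₁ ≢ o →
                          (∀ {y} → y ∈ N₁ → y ≢ v → b₁ ∉ L y × o ∉ L y) → Colouring
    colour-σαv-then-two {c₁} {c₂} {b₁} {o} c₁∈ c₂∈σ₂ c₂∈α₂ b₁∈ o∈ c₁≢c₂ b₁≢c₁ b₁≢c₂ o≢c₁ o≢c₂ b₁≢o unlisted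
      with N₁-avoiding (v ∷ α₂ ∷ []) (s≤s (s≤s (s≤s z≤n)))
    ... | y , y∈N₁ , y∉ with N₁-avoiding (v ∷ α₂ ∷ y ∷ []) (s≤s (s≤s (s≤s (s≤s z≤n))))
    ...   | u , u∈N₁ , u∉ =
      complete P (λ { refl → u∉ (there (there (here refl))) }) (avoids-keys y∈N₁ (y∉ ∘ here) (y∉ ∘ there ∘ here))
        (avoids-keys u∈N₁ (u∉ ∘ here) (u∉ ∘ there ∘ here))
        (adjacent-core (N₁-core y∈N₁) (N₁-core u∈N₁) (λ { refl → u∉ (there (there (here refl))) }))
        (rest-adjacent (there (here refl)) (there (there (here refl))) (N₁-core y∈N₁) (N₁-core u∈N₁))
        (slack-at y∈N₁ (y∉ ∘ here) (y∉ ∘ there ∘ here) (s≤s z≤n))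
        (slack-at u∈N₁ (u∉ ∘ here) (u∉ ∘ there ∘ here) ≤-refl)
      where
      P₀ = σα-precolouring c₁∈ c₂∈σ₂ b₁∈ c₂∈α₂ (λ _ → c₁≢c₂) (λ _ → c₁≢c₂) (λ _ → ≢-sym b₁≢c₂) b₁≢c₂
      P = extend-precolouring P₀ (All¬⇒¬Any (proj₁ v-core ∷ proj₂ v-core ∷ v≢α₁ ∷ v≢α₂ ∷ [])) o∈
            (λ { (here refl) _ → o≢c₁ ; (there (here refl)) _ → o≢c₂ ; (there (there (here refl))) _ → ≢-sym b₁≢o
               ; (there (there (there (here refl)))) _ → o≢c₂ })
      open Precolouring P using (keys)
      avoids-keys : ∀ {y} → y ∈ N₁ → y ≢ v → y ≢ α₂ → y ∉ keys
      avoids-keys y∈N₁ y≢v y≢α₂ =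
        All¬⇒¬Any (y≢v ∷ proj₁ (N₁-core y∈N₁) ∷ proj₂ (N₁-core y∈N₁) ∷ N₁≢α₁ y∈N₁ ∷ y≢α₂ ∷ [])
      slack-at : ∀ {y k} → y ∈ N₁ → y ≢ v → y ≢ α₂ → k ≤ 2 → Slack P y k
      slack-at {y} y∈N₁ y≢v y≢α₂ k≤2 = slack P (σ₁ ∷ α₁ ∷ α₂ ∷ v ∷ [])
        ((≢-sym α₁≢σ₁ ∷ ≢-sym α₂≢σ₁ ∷ ≢-sym (proj₁ v-core) ∷ []) ∷ (α₁≢α₂ ∷ ≢-sym v≢α₁ ∷ []) ∷ (≢-sym v≢α₂ ∷ []) ∷ [] ∷ [])
        (λ { (here refl) → there (here refl) ; (there (here refl)) → there (there (there (here refl)))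
           ; (there (there (here refl))) → there (there (there (there (here refl))))
           ; (there (there (there (here refl)))) → here refl })
        (λ { (here refl) → N₁~σ₁ y∈N₁
           ; (there (here refl)) → adjacent-core (N₁-core y∈N₁) α₁-core (N₁≢α₁ y∈N₁)
           ; (there (there (here refl))) → adjacent-core (N₁-core y∈N₁) α₂-core y≢α₂
           ; (there (there (there (here refl)))) → adjacent-core (N₁-core y∈N₁) v-core y≢v })
        (c₁ ∷ c₂ ∷ []) (+-monoˡ-≤ 2 k≤2)
        (λ { (here refl) o∈Ly → contradiction o∈Ly (proj₂ (unlisted y∈N₁ y≢v))
           ; (there (here refl)) _ → here refl
           ; (there (there (here refl))) _ → there (here refl)
           ; (there (there (there (here refl)))) b₁∈Ly → contradiction b₁∈Ly (proj₁ (unlisted y∈N₁ y≢v))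
           ; (there (there (there (there (here refl))))) _ → there (here refl) })

    -- Colouring σ₁ with c and α₁ with b puts at most one colour of L x on them.
    Merged : V → ℕ → ℕ → Set
    Merged x c b = c ≡ b ⊎ c ∉ L x ⊎ b ∉ L x

    merged-absorbs : ∀ {x c₁ c₂ b₁} → Merged x c₁ b₁ → ∃[ W ] length W ≤ 2 × Absorbs x W (c₁ ∷ c₂ ∷ b₁ ∷ c₂ ∷ [])
    merged-absorbs {c₁ = c₁} {c₂} (inj₁ refl) = c₁ ∷ c₂ ∷ [] , s≤s (s≤s z≤n) ,
      λ { (here refl) _ → here refl ; (there (here refl)) _ → there (here refl)
        ; (there (there (here refl))) _ → here refl ; (there (there (there (here refl)))) _ → there (here refl) }
    merged-absorbs {c₂ = c₂} {b₁} (inj₂ (inj₁ c₁∉)) = b₁ ∷ c₂ ∷ [] , s≤s (s≤s z≤n) ,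
      λ { (here refl) c₁∈ → contradiction c₁∈ c₁∉ ; (there (here refl)) _ → there (here refl)
        ; (there (there (here refl))) _ → here refl ; (there (there (there (here refl)))) _ → there (here refl) }
    merged-absorbs {c₁ = c₁} {c₂} (inj₂ (inj₂ b₁∉)) = c₁ ∷ c₂ ∷ [] , s≤s (s≤s z≤n) ,
      λ { (here refl) _ → here refl ; (there (here refl)) _ → there (here refl)
        ; (there (there (here refl))) b₁∈ → contradiction b₁∈ b₁∉ ; (there (there (there (here refl)))) _ → there (here refl) }

    colour-sharing-σ₂α₂ : ∀ {c₁ c₂ b₁} → c₁ ∈ L σ₁ → b₁ ∈ L α₁ → c₂ ∈ L σ₂ → c₂ ∈ L α₂ → c₁ ≢ c₂ → b₁ ≢ c₂ →
                          Merged v c₁ b₁ → (∀ {y} → y ∈ N₁ → y ≢ v → Merged y c₁ b₁) → Colouring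
    colour-sharing-σ₂α₂ c₁∈ b₁∈ c₂∈σ₂ c₂∈α₂ c₁≢c₂ b₁≢c₂ v-merged y-merged =
      colour-σα-then-v c₁∈ c₂∈σ₂ b₁∈ c₂∈α₂ (λ _ → c₁≢c₂) (λ _ → c₁≢c₂) (λ _ → ≢-sym b₁≢c₂) b₁≢c₂
        (merged-absorbs v-merged) (λ y∈N₁ y≢v _ → merged-absorbs (y-merged y∈N₁ y≢v))

    colour-sharing-σ₁σ₂α₁ : ∀ {c} → c ∈ L σ₁ → c ∈ L σ₂ → c ∈ L α₁ →
                            adj Q σ₁ σ₂ ≢ true → adj Q σ₂ α₁ ≢ true → Colouring
    colour-sharing-σ₁σ₂α₁ {c} c∈σ₁ c∈σ₂ c∈α₁ σ₁≁σ₂ σ₂≁α₁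
      with Colours.pigeonhole (c ∷ []) (L-unique α₂) (≤-trans (s≤s (s≤s z≤n)) (core-list≥3+m α₂-core))
    ... | b₂ , b₂∈ , b₂∉ =
      colour-σα-then-v c∈σ₁ c∈σ₂ c∈α₁ b₂∈ (λ σ₁~σ₂ → contradiction σ₁~σ₂ σ₁≁σ₂) (λ _ c≡b₂ → b₂∉ (here (sym c≡b₂)))
        (λ σ₂~α₁ → contradiction σ₂~α₁ σ₂≁α₁) (λ c≡b₂ → b₂∉ (here (sym c≡b₂)))
        (c ∷ b₂ ∷ [] , ≤-refl , absorbs) (λ _ _ _ → c ∷ b₂ ∷ [] , ≤-refl , absorbs)
      where
      absorbs : ∀ {x} → Absorbs x (c ∷ b₂ ∷ []) (c ∷ c ∷ c ∷ b₂ ∷ [])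
      absorbs (here refl) _ = here refl
      absorbs (there (here refl)) _ = here refl
      absorbs (there (there (here refl))) _ = here refl
      absorbs (there (there (there (here refl)))) _ = there (here refl)

  list≥3 : (F : Frame) → ∀ x → 3 ≤ length (L x)
  list≥3 F x with x Fin.≟ Frame.σ₁ F | x Fin.≟ Frame.σ₂ F
  ... | yes refl | _ = ≤-trans (n≤1+n 3) (FrameFacts.σ₁-list≥4 F)
  ... | no _ | yes refl = ≤-trans (n≤1+n 3) (FrameFacts.σ₁-list≥4 (swap F))
  ... | no x≢σ₁ | no x≢σ₂ = ≤-trans (m≤m+n 3 m) (FrameFacts.core-list≥3+m F (x≢σ₁ , x≢σ₂))

  -- Case analysis on the pot

  module PotFacts (π : Pot) (F : Frame) where
    open Pot π
    open Frame F
    open FrameFacts F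
    open PotProperties π

    crowding : ∀ M → Unique M → (∀ {u} → u ∈ M → ¬ Inside u) → ∀ {k} → k ≤ length pot → 7 + m ≤ length M + k → ⊥
    crowding M M! M-outside k≤pot enough = <⇒≱ (room M M! M-outside) (≤-trans enough (+-monoʳ-≤ (length M) k≤pot))

    pot≤6+m : length pot ≤ 6 + m
    pot≤6+m = ≤-pred (room [] [] (λ ()))

    pot≥3+m : 3 + m ≤ length pot
    pot≥3+m with pigeonhole [] D! (≤-trans (s≤s z≤n) crowded)
    ... | x₀ , x₀∈D , _ with pigeonhole (σ₁ ∷ σ₂ ∷ []) D! (≤-trans three (<⇒≤ crowded))
      where
      three : 3 ≤ length pot
      three = ≤-trans (list≥3 F x₀) (inside-≤ (D-inside x₀∈D))
    ...   | w , w∈D , w∉σs = ≤-trans (core-list≥3+m (w∉σs ∘ here , w∉σs ∘ there ∘ here)) (inside-≤ (D-inside w∈D))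

    -- If the pot had only 3 + m colours, all of N₁ would lie outside it.
    pot≥4+m : 4 + m ≤ length pot
    pot≥4+m with 4 + m ≤? length pot
    ... | yes large = large
    ... | no small = ⊥-elim (crowding N₁ N₁-unique N₁-outside pot≥3+m (≤-trans (n≤1+n (7 + m)) (+-monoˡ-≤ (3 + m) N₁-large)))
      where
      N₁-outside : ∀ {u} → u ∈ N₁ → ¬ Inside u
      N₁-outside u∈N₁ u-inside = small (≤-trans (core-list≥4+m (N₁-core u∈N₁) (here refl) (N₁~σ₁ u∈N₁)) (inside-≤ u-inside))

    inside-unless-v : Inside v → ∀ {x z} → ¬ Inside x → z ≢ x → Inside z
    inside-unless-v v-inside {x} {z} x-outside z≢x with within? pot z
    ... | yes z-inside = z-inside
    ... | no z-outside = ⊥-elim (crowding (x ∷ z ∷ []) ((≢-sym z≢x ∷ []) ∷ [] ∷ [])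
                           (λ { (here refl) → x-outside ; (there (here refl)) → z-outside })
                           (≤-trans v-list≥5+m (inside-≤ v-inside)) ≤-refl)

    inside-unless : ∀ {x x′ z} → x ≢ x′ → ¬ Inside x → ¬ Inside x′ → z ≢ x → z ≢ x′ → Inside z
    inside-unless {x} {x′} {z} x≢x′ x-outside x′-outside z≢x z≢x′ with within? pot z
    ... | yes z-inside = z-inside
    ... | no z-outside = ⊥-elim (crowding (x ∷ x′ ∷ z ∷ []) ((x≢x′ ∷ ≢-sym z≢x ∷ []) ∷ (≢-sym z≢x′ ∷ []) ∷ [] ∷ [])
                           (λ { (here refl) → x-outside ; (there (here refl)) → x′-outside ; (there (there (here refl))) → z-outside })
                           pot≥4+m ≤-refl)

    pot≤4+m : ∀ {x} → v ≢ x → ¬ Inside v → ¬ Inside x → length pot ≤ 4 + m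
    pot≤4+m {x} v≢x v-outside x-outside = ≤-pred (≤-pred (≤-pred (room (v ∷ x ∷ []) ((v≢x ∷ []) ∷ [] ∷ [])
      (λ { (here refl) → v-outside ; (there (here refl)) → x-outside }))))

    σ₁α₁-lists : 7 + m ≤ length (L σ₁) + length (L α₁)
    σ₁α₁-lists = +-mono-≤ σ₁-list≥4 (core-list≥3+m α₁-core)

    σ₂α₂-lists : 7 + m ≤ length (L σ₂) + length (L α₂)
    σ₂α₂-lists = +-mono-≤ (FrameFacts.σ₁-list≥4 (swap F)) (core-list≥3+m α₂-core)

    other-than : ∀ x c → ∃[ b ] b ∈ L x × b ≢ c
    other-than x c with Colours.pigeonhole (c ∷ []) (L-unique x) (≤-trans (n≤1+n 2) (list≥3 F x))
    ... | b , b∈Lx , b∉[c] = b , b∈Lx , b∉[c] ∘ here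

    separated-by-pot : ∀ {c c′} → c ∉ pot → c′ ∈ pot → c ≢ c′
    separated-by-pot c∉pot c′∈pot refl = c∉pot c′∈pot

    from-σ₁α₁-common : Inside σ₂ → Inside α₂ → 2 + length pot ≤ length (L σ₂) + length (L α₂) →
                       ∀ {c} → c ∈ L σ₁ → c ∈ L α₁ → Colouring
    from-σ₁α₁-common σ₂-in α₂-in enough {c} c∈σ₁ c∈α₁ with shared σ₂-in α₂-in (c ∷ []) enough
    ... | c₂ , c₂∈σ₂ , c₂∈α₂ , c₂∉[c] =
      colour-sharing-σ₂α₂ c∈σ₁ c∈α₁ c₂∈σ₂ c₂∈α₂ c≢c₂ c≢c₂ (inj₁ refl) (λ _ _ → inj₁ refl)
      where
      c≢c₂ : c ≢ c₂
      c≢c₂ c≡c₂ = c₂∉[c] (here (sym c≡c₂))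

    from-σ₂α₂-common : Inside σ₁ → Inside α₁ → 2 + length pot ≤ length (L σ₁) + length (L α₁) →
                       ∀ {c} → c ∈ L σ₂ → c ∈ L α₂ → Colouring
    from-σ₂α₂-common σ₁-in α₁-in enough {c} c∈σ₂ c∈α₂ with shared σ₁-in α₁-in (c ∷ []) enough
    ... | c₁ , c₁∈σ₁ , c₁∈α₁ , c₁∉[c] =
      colour-sharing-σ₂α₂ c₁∈σ₁ c₁∈α₁ c∈σ₂ c∈α₂ (c₁∉[c] ∘ here) (c₁∉[c] ∘ here) (inj₁ refl) (λ _ _ → inj₁ refl)

    all-inside : Inside σ₁ → Inside α₁ → Inside σ₂ → Inside α₂ → Colouring
    all-inside σ₁-in α₁-in σ₂-in α₂-in
      with shared σ₁-in α₁-in [] (≤-trans (s≤s pot≤6+m) σ₁α₁-lists) | shared σ₂-in α₂-in [] (≤-trans (s≤s pot≤6+m) σ₂α₂-lists)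
    ... | c₁ , c₁∈σ₁ , c₁∈α₁ , _ | c₂ , c₂∈σ₂ , c₂∈α₂ , _ with c₁ Data.Nat.≟ c₂
    ... | no c₁≢c₂ = colour-sharing-σ₂α₂ c₁∈σ₁ c₁∈α₁ c₂∈σ₂ c₂∈α₂ c₁≢c₂ c₁≢c₂ (inj₁ refl) (λ _ _ → inj₁ refl)
    -- One shared colour for both pairs: an extra neighbour of σ₁ or of an α lengthens
    -- a list enough to choose another, unless σ₁, σ₂, α₁ are pairwise non-adjacent.
    ... | yes refl with adj Q σ₁ σ₂ Bool.≟ true | adj Q σ₁ α₂ Bool.≟ true | adj Q σ₂ α₁ Bool.≟ true
    ...   | yes σ₁~σ₂ | _ | _ = from-σ₁α₁-common σ₂-in α₂-in
            (≤-trans (s≤s (s≤s pot≤6+m)) (+-mono-≤ (FrameFacts.σ₁-list≥5 (swap F) (adjacent-sym σ₁~σ₂)) (core-list≥3+m α₂-core)))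
            c₁∈σ₁ c₁∈α₁
    ...   | no _ | yes σ₁~α₂ | _ = from-σ₁α₁-common σ₂-in α₂-in
            (≤-trans (s≤s (s≤s pot≤6+m)) (+-mono-≤ (FrameFacts.σ₁-list≥4 (swap F)) (core-list≥4+m α₂-core (here refl) (adjacent-sym σ₁~α₂))))
            c₁∈σ₁ c₁∈α₁
    ...   | no _ | no _ | yes σ₂~α₁ = from-σ₂α₂-common σ₁-in α₁-in
            (≤-trans (s≤s (s≤s pot≤6+m)) (+-mono-≤ σ₁-list≥4 (core-list≥4+m α₁-core (there (here refl)) (adjacent-sym σ₂~α₁))))
            c₂∈σ₂ c₂∈α₂
    ...   | no σ₁≁σ₂ | no _ | no σ₂≁α₁ = colour-sharing-σ₁σ₂α₁ c₁∈σ₁ c₂∈σ₂ c₁∈α₁ σ₁≁σ₂ σ₂≁α₁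

    σ₁-colour-unseen : Inside σ₂ → Inside α₂ → (∀ {y} → y ∈ N₁ → y ≢ v → Inside y) →
                       ∀ {e} → e ∈ L σ₁ → e ∉ pot → e ∉ L v → Colouring
    σ₁-colour-unseen σ₂-in α₂-in N₁-in e∈σ₁ e∉pot e∉Lv
      with shared σ₂-in α₂-in [] (≤-trans (s≤s pot≤6+m) σ₂α₂-lists)
    ... | c₂ , c₂∈σ₂ , c₂∈α₂ , _ with other-than α₁ c₂
    ...   | b₁ , b₁∈α₁ , b₁≢c₂ =
      colour-sharing-σ₂α₂ e∈σ₁ b₁∈α₁ c₂∈σ₂ c₂∈α₂ (separated-by-pot e∉pot (inside-⊆ σ₂-in c₂∈σ₂)) b₁≢c₂
        (inj₂ (inj₁ e∉Lv)) (λ y∈N₁ y≢v → inj₂ (inj₁ (e∉pot ∘ inside-⊆ (N₁-in y∈N₁ y≢v))))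

    α₁-colour-unseen : Inside σ₂ → Inside α₂ → (∀ {y} → y ∈ N₁ → y ≢ v → Inside y) →
                       ∀ {e} → e ∈ L α₁ → e ∉ pot → e ∉ L v → Colouring
    α₁-colour-unseen σ₂-in α₂-in N₁-in e∈α₁ e∉pot e∉Lv
      with shared σ₂-in α₂-in [] (≤-trans (s≤s pot≤6+m) σ₂α₂-lists)
    ... | c₂ , c₂∈σ₂ , c₂∈α₂ , _ with other-than σ₁ c₂
    ...   | c₁ , c₁∈σ₁ , c₁≢c₂ =
      colour-sharing-σ₂α₂ c₁∈σ₁ e∈α₁ c₂∈σ₂ c₂∈α₂ c₁≢c₂ (separated-by-pot e∉pot (inside-⊆ σ₂-in c₂∈σ₂))
        (inj₂ (inj₂ e∉Lv)) (λ y∈N₁ y≢v → inj₂ (inj₂ (e∉pot ∘ inside-⊆ (N₁-in y∈N₁ y≢v))))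

    inside-v-outside-σ₁ : Inside v → ¬ Inside σ₁ → Colouring
    inside-v-outside-σ₁ v-in σ₁-out =
      let e , e∈σ₁ , e∉pot = escape σ₁-out in
      σ₁-colour-unseen (inside-unless-v v-in σ₁-out (≢-sym σ₁≢σ₂)) (inside-unless-v v-in σ₁-out α₂≢σ₁)
        (λ y∈N₁ _ → inside-unless-v v-in σ₁-out (proj₁ (N₁-core y∈N₁))) e∈σ₁ e∉pot (e∉pot ∘ inside-⊆ v-in)

    inside-v-outside-α₁ : Inside v → ¬ Inside α₁ → Colouring
    inside-v-outside-α₁ v-in α₁-out =
      let e , e∈α₁ , e∉pot = escape α₁-out in
      α₁-colour-unseen (inside-unless-v v-in α₁-out (≢-sym α₁≢σ₂)) (inside-unless-v v-in α₁-out (≢-sym α₁≢α₂))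
        (λ y∈N₁ _ → inside-unless-v v-in α₁-out (N₁≢α₁ y∈N₁)) e∈α₁ e∉pot (e∉pot ∘ inside-⊆ v-in)

    module _ (v-out : ¬ Inside v) (σ₁-out : ¬ Inside σ₁) where

      private
        others-in : ∀ {z} → z ≢ v → z ≢ σ₁ → Inside z
        others-in = inside-unless (proj₁ v-core) v-out σ₁-out
        σ₂-in : Inside σ₂
        σ₂-in = others-in (≢-sym (proj₂ v-core)) (≢-sym σ₁≢σ₂)
        α₁-in : Inside α₁
        α₁-in = others-in (≢-sym v≢α₁) α₁≢σ₁
        α₂-in : Inside α₂
        α₂-in = others-in (≢-sym v≢α₂) α₂≢σ₁
        N₁-in : ∀ {y} → y ∈ N₁ → y ≢ v → Inside y
        N₁-in y∈N₁ y≢v = others-in y≢v (proj₁ (N₁-core y∈N₁))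
        small-pot : length pot ≤ 4 + m
        small-pot = pot≤4+m (proj₁ v-core) v-out σ₁-out
        enough : 2 + length pot ≤ length (L σ₂) + length (L α₂)
        enough = ≤-trans (s≤s (s≤s small-pot)) (≤-trans (n≤1+n (6 + m)) σ₂α₂-lists)

        split-unseen : ∀ {c₁ b₁} → c₁ ∈ L σ₁ → c₁ ∉ pot → b₁ ∈ L α₁ → b₁ ∉ L v → Colouring
        split-unseen {c₁} {b₁} c₁∈σ₁ c₁∉pot b₁∈α₁ b₁∉Lv with shared σ₂-in α₂-in (b₁ ∷ []) enough
        ... | c₂ , c₂∈σ₂ , c₂∈α₂ , c₂∉[b₁] =
          colour-sharing-σ₂α₂ c₁∈σ₁ b₁∈α₁ c₂∈σ₂ c₂∈α₂ (separated-by-pot c₁∉pot (inside-⊆ σ₂-in c₂∈σ₂))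
            (λ b₁≡c₂ → c₂∉[b₁] (here (sym b₁≡c₂)))
            (inj₂ (inj₂ b₁∉Lv)) (λ y∈N₁ y≢v → inj₂ (inj₁ (c₁∉pot ∘ inside-⊆ (N₁-in y∈N₁ y≢v))))

        -- L α₁ ⊆ pot ∩ L v, so pot and L v cannot accommodate both L σ₁ and L α₁.
        too-many : Disjoint (L σ₁) (L α₁) → (∀ {c} → c ∈ L σ₁ → c ∈ pot ⊎ c ∈ L v) → L α₁ ⊆ L v → ⊥
        too-many σ₁#α₁ σ₁⊆pot∪v α₁⊆v = <-irrefl refl (begin-strict
          (4 + m) + (5 + m)                                    <⟨ ≤-reflexive (lists-needed m) ⟩
          4 + ((3 + m) + (3 + m))                              ≤⟨ +-mono-≤ σ₁-list≥4 (+-mono-≤ α₁-list α₁-list) ⟩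
          length (L σ₁) + (length (L α₁) + length (L α₁))      ≤⟨ Colours.union-bound (L-unique σ₁) (L-unique α₁) σ₁#α₁
                                                                    (inside-⊆ α₁-in) α₁⊆v σ₁⊆pot∪v ⟩
          length pot + length (L v)                            ≤⟨ +-mono-≤ small-pot (list≤5+m v) ⟩
          (4 + m) + (5 + m)                                    ∎)
          where
          open ≤-Reasoning
          α₁-list = core-list≥3+m α₁-core
          lists-needed : ∀ m → suc ((4 + m) + (5 + m)) ≡ 4 + ((3 + m) + (3 + m))
          lists-needed = solve-∀

      outside-v-σ₁ : Colouring
      outside-v-σ₁ with any? (_∈ℕ? L α₁) (L σ₁)
      ... | yes common = let c , c∈σ₁ , c∈α₁ = find common in from-σ₁α₁-common σ₂-in α₂-in enough c∈σ₁ c∈α₁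
      ... | no σ₁#α₁ with any? (λ c → ¬? (c ∈ℕ? pot) ×-dec ¬? (c ∈ℕ? L v)) (L σ₁)
      ...   | yes unseen = let c , c∈σ₁ , c∉pot , c∉Lv = find unseen in σ₁-colour-unseen σ₂-in α₂-in N₁-in c∈σ₁ c∉pot c∉Lv
      ...   | no none-unseen with any? (λ b → ¬? (b ∈ℕ? L v)) (L α₁)
      ...     | yes fresh = let b , b∈α₁ , b∉Lv = find fresh ; c , c∈σ₁ , c∉pot = escape σ₁-out in
                            split-unseen c∈σ₁ c∉pot b∈α₁ b∉Lv
      ...     | no none-fresh = ⊥-elim (too-many (λ (c∈σ₁ , c∈α₁) → σ₁#α₁ (lose c∈σ₁ c∈α₁)) σ₁⊆pot∪v α₁⊆v)
        where
        σ₁⊆pot∪v : ∀ {c} → c ∈ L σ₁ → c ∈ pot ⊎ c ∈ L v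
        σ₁⊆pot∪v {c} c∈σ₁ with c ∈ℕ? pot | c ∈ℕ? L v
        ... | yes c∈pot | _ = inj₁ c∈pot
        ... | no _ | yes c∈Lv = inj₂ c∈Lv
        ... | no c∉pot | no c∉Lv = ⊥-elim (none-unseen (lose c∈σ₁ (c∉pot , c∉Lv)))
        α₁⊆v : L α₁ ⊆ L v
        α₁⊆v {b} b∈α₁ = decidable-stable (b ∈ℕ? L v) (none-fresh ∘ lose b∈α₁)

    module _ (v-out : ¬ Inside v) (α₁-out : ¬ Inside α₁) where

      private
        others-in : ∀ {z} → z ≢ v → z ≢ α₁ → Inside z
        others-in = inside-unless v≢α₁ v-out α₁-out
        σ₁-in : Inside σ₁
        σ₁-in = others-in (≢-sym (proj₁ v-core)) (≢-sym α₁≢σ₁)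
        σ₂-in : Inside σ₂
        σ₂-in = others-in (≢-sym (proj₂ v-core)) (≢-sym α₁≢σ₂)
        α₂-in : Inside α₂
        α₂-in = others-in (≢-sym v≢α₂) (≢-sym α₁≢α₂)
        N₁-in : ∀ {y} → y ∈ N₁ → y ≢ v → Inside y
        N₁-in y∈N₁ y≢v = others-in y≢v (N₁≢α₁ y∈N₁)
        small-pot : length pot ≤ 4 + m
        small-pot = pot≤4+m v≢α₁ v-out α₁-out
        enough : 2 + length pot ≤ length (L σ₂) + length (L α₂)
        enough = ≤-trans (s≤s (s≤s small-pot)) (≤-trans (n≤1+n (6 + m)) σ₂α₂-lists)

        pot∩α₁ : List ℕ
        pot∩α₁ = filter (_∈ℕ? L α₁) pot

        pot∩α₁-small : Disjoint (L σ₁) (L α₁) → length pot∩α₁ ≤ m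
        pot∩α₁-small σ₁#α₁ = +-cancelʳ-≤ 4 (length pot∩α₁) m (begin
          length pot∩α₁ + 4              ≤⟨ +-monoʳ-≤ (length pot∩α₁) σ₁-list≥4 ⟩
          length pot∩α₁ + length (L σ₁)  ≤⟨ Colours.disjoint-⊆⇒length≤ (Unique.filter⁺ (_∈ℕ? L α₁) pot-unique) (L-unique σ₁)
                                              (λ (c∈ , c∈σ₁) → σ₁#α₁ (c∈σ₁ , proj₂ (∈-filter⁻ (_∈ℕ? L α₁) {xs = pot} c∈)))
                                              (proj₁ ∘ ∈-filter⁻ (_∈ℕ? L α₁) {xs = pot}) (inside-⊆ σ₁-in) ⟩
          length pot                     ≤⟨ small-pot ⟩
          4 + m                          ≡⟨ +-comm 4 m ⟩
          m + 4                          ∎)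
          where
            open ≤-Reasoning

        -- Without a common colour of σ₁ and α₁ nothing repeats at v, so v is precoloured
        -- with o ∉ pot; two neighbours of σ₁ are finished last, seeing b₁, o ∉ pot.
        disjoint-σ₁α₁ : Disjoint (L σ₁) (L α₁) → Colouring
        disjoint-σ₁α₁ σ₁#α₁
          with Colours.pigeonhole pot (L-unique v) (≤-trans (s≤s small-pot) v-list≥5+m)
             | Colours.pigeonhole [] (L-unique σ₁) (≤-trans (s≤s z≤n) σ₁-list≥4)
        ... | o , o∈v , o∉pot | c₁ , c₁∈σ₁ , _ with shared σ₂-in α₂-in (c₁ ∷ []) enough
        ...   | c₂ , c₂∈σ₂ , c₂∈α₂ , c₂∉[c₁] with Colours.pigeonhole (o ∷ pot∩α₁) (L-unique α₁)
                                                 (≤-trans (s≤s (s≤s (pot∩α₁-small σ₁#α₁))) (≤-trans (n≤1+n (2 + m)) (core-list≥3+m α₁-core)))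
        ...     | b₁ , b₁∈α₁ , b₁∉ =
          colour-σαv-then-two c₁∈σ₁ c₂∈σ₂ c₂∈α₂ b₁∈α₁ o∈v (λ c₁≡c₂ → c₂∉[c₁] (here (sym c₁≡c₂)))
            (separated-by-pot b₁∉pot (inside-⊆ σ₁-in c₁∈σ₁)) (separated-by-pot b₁∉pot (inside-⊆ σ₂-in c₂∈σ₂))
            (separated-by-pot o∉pot (inside-⊆ σ₁-in c₁∈σ₁)) (separated-by-pot o∉pot (inside-⊆ σ₂-in c₂∈σ₂))
            (b₁∉ ∘ here) (λ y∈N₁ y≢v → b₁∉pot ∘ inside-⊆ (N₁-in y∈N₁ y≢v) , o∉pot ∘ inside-⊆ (N₁-in y∈N₁ y≢v))
          where
          b₁∉pot : b₁ ∉ pot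
          b₁∉pot b₁∈pot = b₁∉ (there (∈-filter⁺ (_∈ℕ? L α₁) b₁∈pot b₁∈α₁))

      outside-v-α₁ : Colouring
      outside-v-α₁ with any? (_∈ℕ? L α₁) (L σ₁)
      ... | yes common = let c , c∈σ₁ , c∈α₁ = find common in from-σ₁α₁-common σ₂-in α₂-in enough c∈σ₁ c∈α₁
      ... | no σ₁#α₁ = disjoint-σ₁α₁ (λ (c∈σ₁ , c∈α₁) → σ₁#α₁ (lose c∈σ₁ c∈α₁))

    σ₁-outside : ¬ Inside σ₁ → Colouring
    σ₁-outside σ₁-out with within? pot v
    ... | yes v-in = inside-v-outside-σ₁ v-in σ₁-out
    ... | no v-out = outside-v-σ₁ v-out σ₁-out

    α₁-outside : ¬ Inside α₁ → Colouring
    α₁-outside α₁-out with within? pot v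
    ... | yes v-in = inside-v-outside-α₁ v-in α₁-out
    ... | no v-out = outside-v-α₁ v-out α₁-out

  colour-from-pot : Pot → Frame → Colouring
  colour-from-pot π F
    with within? pot σ₁ | within? pot α₁ | within? pot σ₂ | within? pot α₂
    where
    open Pot π
    open Frame F
  ... | yes σ₁-in | yes α₁-in | yes σ₂-in | yes α₂-in = PotFacts.all-inside π F σ₁-in α₁-in σ₂-in α₂-in
  ... | no σ₁-out | _ | _ | _ = PotFacts.σ₁-outside π F σ₁-out
  ... | yes _ | no α₁-out | _ | _ = PotFacts.α₁-outside π F α₁-out
  ... | yes _ | yes _ | no σ₂-out | _ = PotFacts.σ₁-outside π (swap F) σ₂-out
  ... | yes _ | yes _ | yes _ | no α₂-out = PotFacts.α₁-outside π (swap F) α₂-out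

  K-neighbours : V → List V
  K-neighbours s = map K (filter (λ k → adj Q s (K k) Bool.≟ true) (allFin (5 + m)))

  module _ (s : V) where
    private
      s~? : (k : Fin (5 + m)) → Dec (adj Q s (K k) ≡ true)
      s~? k = adj Q s (K k) Bool.≟ true

    K-neighbours-unique : Unique (K-neighbours s)
    K-neighbours-unique = Unique.map⁺ (Fin.suc-injective ∘ Fin.suc-injective) (Unique.filter⁺ s~? (Unique.allFin⁺ (5 + m)))

    K-neighbours-adjacent : ∀ {u} → u ∈ K-neighbours s → adj Q u s ≡ true
    K-neighbours-adjacent u∈ with ∈-map⁻ K u∈
    ... | k , k∈ , refl = adjacent-sym (proj₂ (∈-filter⁻ s~? {xs = allFin (5 + m)} k∈))

    K-neighbours-≢s₂ : ∀ {u} → u ∈ K-neighbours s → u ≢ s₂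
    K-neighbours-≢s₂ u∈ with ∈-map⁻ K u∈
    ... | k , _ , refl = λ ()

    K-neighbours-≢s₁ : ∀ {u} → u ∈ K-neighbours s → u ≢ s₁
    K-neighbours-≢s₁ u∈ with ∈-map⁻ K u∈
    ... | k , _ , refl = λ ()

    K-neighbours-length : length (K-neighbours s) ≡ countTrue (λ k → adj Q s (K k))
    K-neighbours-length = trans (length-map K (filter s~? (allFin (5 + m)))) (sym (countTrue≡length-filter (λ k → adj Q s (K k))))

  standard-frame : (∀ (k k′ : Fin (5 + m)) → k ≢ k′ → adj Q (K k) (K k′) ≡ true) →
                   (v : Fin (5 + m)) → adj Q s₁ (K v) ≡ true → adj Q s₂ (K v) ≡ true →
                   countTrue (λ k → adj Q s₁ (K k)) ≥ 5 → countTrue (λ k → adj Q s₂ (K k)) ≥ 5 →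
                   (a₁ a₂ : Fin (5 + m)) → a₁ ≢ a₂ → adj Q s₁ (K a₁) ≡ false → adj Q s₂ (K a₂) ≡ false → Frame
  standard-frame clique v s₁~v s₂~v many₁ many₂ a₁ a₂ a₁≢a₂ s₁≁a₁ s₂≁a₂ = record
    { σ₁ = s₁ ; σ₂ = s₂ ; α₁ = K a₁ ; α₂ = K a₂ ; v = K v ; σ₁≢σ₂ = λ ()
    ; clique = K-clique
    ; α₁≢σ₁ = λ () ; α₁≢σ₂ = λ () ; α₂≢σ₁ = λ () ; α₂≢σ₂ = λ ()
    ; α₁≢α₂ = a₁≢a₂ ∘ Fin.suc-injective ∘ Fin.suc-injective
    ; σ₁≁α₁ = non-adjacent s₁≁a₁ ; σ₂≁α₂ = non-adjacent s₂≁a₂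
    ; v~σ₁ = adjacent-sym s₁~v ; v~σ₂ = adjacent-sym s₂~v
    ; N₁ = K-neighbours s₁ ; N₂ = K-neighbours s₂
    ; N₁-unique = K-neighbours-unique s₁ ; N₂-unique = K-neighbours-unique s₂
    ; N₁~σ₁ = K-neighbours-adjacent s₁ ; N₂~σ₂ = K-neighbours-adjacent s₂
    ; N₁≢σ₂ = K-neighbours-≢s₂ s₁ ; N₂≢σ₁ = K-neighbours-≢s₁ s₂
    ; N₁-large = subst (5 ≤_) (sym (K-neighbours-length s₁)) many₁
    ; N₂-large = subst (5 ≤_) (sym (K-neighbours-length s₂)) many₂
    }
    where
    non-adjacent : ∀ {u w} → adj Q u w ≡ false → adj Q u w ≢ true
    non-adjacent u≁w u~w with () ← trans (sym u≁w) u~w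
    K-clique : ∀ {u w : V} → u ≢ s₁ → u ≢ s₂ → w ≢ s₁ → w ≢ s₂ → u ≢ w → adj Q u w ≡ true
    K-clique {Fin.zero} u≢s₁ _ _ _ _ = contradiction refl u≢s₁
    K-clique {Fin.suc Fin.zero} _ u≢s₂ _ _ _ = contradiction refl u≢s₂
    K-clique {Fin.suc (Fin.suc _)} {Fin.zero} _ _ w≢s₁ _ _ = contradiction refl w≢s₁
    K-clique {Fin.suc (Fin.suc _)} {Fin.suc Fin.zero} _ _ _ w≢s₂ _ = contradiction refl w≢s₂
    K-clique {Fin.suc (Fin.suc k)} {Fin.suc (Fin.suc k′)} _ _ _ _ u≢w = clique k k′ (u≢w ∘ cong K)

lemmaB1 : (d : ℕ) → 5 ≤ d → (Q : Graph (2 + d)) →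
    (∀ (k k′ : Fin d) → k ≢ k′ → adj Q (K k) (K k′) ≡ true) →
    (∃ λ (v : Fin d) → (adj Q s₁ (K v) ≡ true) × (adj Q s₂ (K v) ≡ true)) →
    countTrue (λ (k : Fin d) → adj Q s₁ (K k)) ≥ 5 →
    countTrue (λ (k : Fin d) → adj Q s₂ (K k)) ≥ 5 →
    (Σ (Fin d) λ a₁ → Σ (Fin d) λ a₂ →
      (a₁ ≢ a₂) × (adj Q s₁ (K a₁) ≡ false) × (adj Q s₂ (K a₂) ≡ false)) →
    DegMinus1Choosable Q
lemmaB1 (suc (suc (suc (suc (suc m))))) (s≤s (s≤s (s≤s (s≤s (s≤s z≤n))))) Q clique (v , s₁~v , s₂~v) many₁ many₂
        (a₁ , a₂ , a₁≢a₂ , s₁≁a₁ , s₂≁a₂) L L-unique L-size =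
  [ id , (λ π → colour-from-pot π frame) ] colouring-or-pot
  where
  open ListColouring Q L L-unique L-size using (colouring-or-pot)
  open Analysis m Q L L-unique L-size using (colour-from-pot; standard-frame)
  frame = standard-frame clique v s₁~v s₂~v many₁ many₂ a₁ a₂ a₁≢a₂ s₁≁a₁ s₂≁a₂
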